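{- Let $N\geq5$ be odd. Suppose $C(X)=\sum_{n=1}^{(N-3)/2}c_{n} X^{2n}\in\mathbb{Q}[X]$ satisfies \[ C(X)-C(1+X)-X^{N-2}C\Big(1+\frac{1}{X}\Big)=c+(\text{an odd polynomial in }X) \] for some constant $c\in\mathbb{Q}$, and that $C(X)=X^{N-2}q'(\frac{1}{X})$ for a polynomial $q\in\mathbb{Q}[X]$ with $q(X)+X^{N-1}q(\frac{1}{X})=0$ and $q(0)=0$. Then $q\in W_{N+1}^-$.
   Context: For even $h>2$, $W_h$ is the space of $P\in\mathbb{Q}[X]$ with $P(X)+X^{h-2}P(-1/X)=0$ and $P(X)+X^{h-2}P(1-1/X)+(X-1)^{h-2}P(-1/(X-1))=0$; $W_h^-=\{P\in W_h: P(0)=0,\ P(X)+X^{h-2}P(1/X)=0\}$. $q'$ is the derivative of $q$. -}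

module Defs where

open import Data.Nat as ℕ using (ℕ; zero; suc)
open import Data.Rational using (ℚ; 0ℚ; 1ℚ; _+_; _*_; _-_; -_; 1/_; ≢-nonZero; _/_)
open import Data.Integer using (+_)
open import Data.List using (List; []; _∷_)
open import Data.Product using (_×_)
open import Relation.Binary.PropositionalEquality using (_≡_; _≢_)

-- Polynomials over ℚ as coefficient lists, lowest degree first:
-- a₀ ∷ a₁ ∷ ... represents a₀ + a₁ X + ...
Poly : Set
Poly = List ℚ

eval : Poly → ℚ → ℚ
eval []       x = 0ℚ
eval (a ∷ as) x = a + x * eval as x

pow : ℚ → ℕ → ℚ
pow x zero    = 1ℚ
pow x (suc n) = x * pow x n

fromℕ : ℕ → ℚ
fromℕ n = (+ n) / 1

-- formal derivative: d/dX (Σ aᵢ Xⁱ) = Σ i aᵢ X^(i-1)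
-- derivAux k (a_k ∷ a_{k+1} ∷ ...) = k a_k ∷ (k+1) a_{k+1} ∷ ...
derivAux : ℕ → Poly → Poly
derivAux k []       = []
derivAux k (a ∷ as) = (fromℕ k * a) ∷ derivAux (suc k) as

deriv : Poly → Poly
deriv []       = []
deriv (a ∷ as) = derivAux 1 as

inv : (x : ℚ) → x ≢ 0ℚ → ℚ
inv x p = 1/_ x {{≢-nonZero p}}

-- W_h : P(X) + X^{h-2} P(-1/X) = 0 and
--       P(X) + X^{h-2} P(1-1/X) + (X-1)^{h-2} P(-1/(X-1)) = 0,
-- identities of rational functions, expressed by evaluation at all
-- rationals where both sides are defined (ℚ infinite, so equivalent).
InW : ℕ → Poly → Set
InW h P =
  ((x : ℚ) (x≢0 : x ≢ 0ℚ) →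
     eval P x + pow x (h ℕ.∸ 2) * eval P (- inv x x≢0) ≡ 0ℚ)
  × ((x : ℚ) (x≢0 : x ≢ 0ℚ) (x-1≢0 : x - 1ℚ ≢ 0ℚ) →
     eval P x + pow x (h ℕ.∸ 2) * eval P (1ℚ - inv x x≢0)
       + pow (x - 1ℚ) (h ℕ.∸ 2) * eval P (- inv (x - 1ℚ) x-1≢0) ≡ 0ℚ)

InW⁻ : ℕ → Poly → Set
InW⁻ h P =
  InW h P
  × eval P 0ℚ ≡ 0ℚ
  × ((x : ℚ) (x≢0 : x ≢ 0ℚ) →
       eval P x + pow x (h ℕ.∸ 2) * eval P (inv x x≢0) ≡ 0ℚ)

sumC : (ℕ → ℚ) → ℕ → ℚ → ℚ
sumC c zero    x = 0ℚ
sumC c (suc n) x = sumC c n x + c (suc n) * pow x (2 ℕ.* suc n)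

IsOddPoly : Poly → Set
IsOddPoly o = (x : ℚ) → eval o (- x) ≡ - eval o x

-- Put w = N - 1 and C(x) = Σ cₙ x^(2n). The relation C(x) = x^(w-1) q′(1/x) determines q′,
-- hence q = Σ bₙ x^(w-2n) since q(0) = 0. For f(x) = q(x) - q(1+x) - (1+x)^w q(x/(1+x)) a
-- direct computation gives (1+x) f′ - w f = m, where m(x) = C(x) - C(1+x) - x^(w-1) C(1+1/x)
-- + q′(x), up to terms that vanish by the reciprocity of q. Now m is x^(w-1)-reciprocal and
-- equals a constant k plus an odd function, which forces m = k (1 + x^(w-1)). Hence
-- ψ = f - (k/w) (x^w - 1 + (1+x)^w) solves (1+x) ψ′ = w ψ with ψ(0) = 0, so ψ = 0, and at
-- x = 1 this gives k = 0 and f = 0. The relations defining W_{N+1} then read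
-- q(x) + x^w q(1/x) = 0 (q is even) and -f(x-1) = 0. Polynomial identities are obtained
-- from their values at the positive integers.

module Submission where

open import Defs
open import Algebra.Bundles using (CommutativeRing)
open import Data.Empty using (⊥-elim)
import Data.Integer as ℤ
import Data.Integer.Properties as ℤP
open import Data.List using (List; []; _∷_; length)
open import Data.List.Relation.Unary.All as All using (All)
open import Data.Nat as ℕ using (ℕ; zero; suc; _≤_; _%_; _∸_; _/_)
open import Data.Nat.Coprimality using (1-coprimeTo) renaming (sym to coprime-sym)
import Data.Nat.DivMod as ℕ
import Data.Nat.Properties as ℕ
open import Data.Product using (Σ; _×_; _,_)
open import Data.Rational using (ℚ; 0ℚ; 1ℚ; _+_; _*_; _-_; -_; mkℚ; ≢-nonZero)
open import Data.Rational.Properties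
  using (_≟_; +-*-commutativeRing; normalize-coprime; *-inverseˡ; 1/-involutive;
         *-comm; *-assoc; *-identityˡ; *-identityʳ; *-zeroˡ; *-zeroʳ; +-identityˡ; +-identityʳ;
         +-assoc; +-comm; +-inverseʳ; *-distribˡ-+; neg-injective; neg-distribˡ-*; neg-distribʳ-*; neg-distrib-+)
open import Level using (0ℓ)
open import Relation.Binary.PropositionalEquality
open import Relation.Nullary using (¬_)
open import Relation.Nullary.Decidable using (dec⇒maybe)
open import Tactic.RingSolver using (solve-∀; solve)
import Tactic.RingSolver.Core.AlmostCommutativeRing as ACR

open CommutativeRing +-*-commutativeRing using (semiring; commutativeSemiring; *-commutativeSemigroup)
open import Algebra.Properties.CommutativeSemigroup *-commutativeSemigroup using (x∙yz≈y∙xz)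
open import Algebra.Properties.Semiring.Exp semiring using (_^_; ^-homo-*)
open import Algebra.Properties.CommutativeSemiring.Exp commutativeSemiring using (^-distrib-*)

ℚ-ring : ACR.AlmostCommutativeRing 0ℓ 0ℓ
ℚ-ring = ACR.fromCommutativeRing +-*-commutativeRing (λ x → dec⇒maybe (0ℚ ≟ x))

-- 1ℚ + mkℚ (+ n) 0 _ computes to (+ 1 ℤ.+ + n ℤ.* + 1) / 1.
fromℕ-suc : ∀ n → fromℕ (suc n) ≡ 1ℚ + fromℕ n
fromℕ-suc n = begin
  fromℕ (suc n)
    ≡⟨ cong (λ i → (ℤ.+ 1 ℤ.+ i) Data.Rational./ 1) (sym (ℤP.*-identityʳ (ℤ.+ n))) ⟩
  1ℚ + mkℚ (ℤ.+ n) 0 n-coprime-1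
    ≡⟨ cong (1ℚ +_) (sym (normalize-coprime n-coprime-1)) ⟩
  1ℚ + fromℕ n
    ∎
  where
  open ≡-Reasoning
  n-coprime-1 = coprime-sym (1-coprimeTo n)

fromℕ-+ : ∀ m n → fromℕ (m ℕ.+ n) ≡ fromℕ m + fromℕ n
fromℕ-+ zero    n = sym (+-identityˡ (fromℕ n))
fromℕ-+ (suc m) n = begin
  fromℕ (suc (m ℕ.+ n))     ≡⟨ fromℕ-suc (m ℕ.+ n) ⟩
  1ℚ + fromℕ (m ℕ.+ n)      ≡⟨ cong (1ℚ +_) (fromℕ-+ m n) ⟩
  1ℚ + (fromℕ m + fromℕ n)  ≡⟨ sym (+-assoc 1ℚ (fromℕ m) (fromℕ n)) ⟩
  (1ℚ + fromℕ m) + fromℕ n  ≡⟨ cong (_+ fromℕ n) (sym (fromℕ-suc m)) ⟩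
  fromℕ (suc m) + fromℕ n   ∎
  where open ≡-Reasoning

fromℕ-suc≢0 : ∀ n → fromℕ (suc n) ≢ 0ℚ
fromℕ-suc≢0 n eq with trans (sym (normalize-coprime {suc n} {0} (coprime-sym (1-coprimeTo (suc n))))) eq
... | ()

x≢0∧x*y≡0⇒y≡0 : ∀ {x y} → x ≢ 0ℚ → x * y ≡ 0ℚ → y ≡ 0ℚ
x≢0∧x*y≡0⇒y≡0 {x} {y} x≢0 xy≡0 = begin
  y                  ≡⟨ sym (*-identityˡ y) ⟩
  1ℚ * y             ≡⟨ cong (_* y) (sym (*-inverseˡ x)) ⟩
  (1/ x) * x * y     ≡⟨ *-assoc (1/ x) x y ⟩
  (1/ x) * (x * y)   ≡⟨ cong ((1/ x) *_) xy≡0 ⟩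
  (1/ x) * 0ℚ        ≡⟨ *-zeroʳ (1/ x) ⟩
  0ℚ                 ∎
  where
  open ≡-Reasoning
  open Data.Rational using (1/_)
  instance _ = ≢-nonZero x≢0

x-y≡0⇒x≡y : ∀ {x y} → x - y ≡ 0ℚ → x ≡ y
x-y≡0⇒x≡y {x} {y} eq = begin
  x            ≡⟨ solve (x ∷ y ∷ []) ℚ-ring ⟩
  (x - y) + y  ≡⟨ cong (_+ y) eq ⟩
  0ℚ + y       ≡⟨ +-identityˡ y ⟩
  y            ∎
  where open ≡-Reasoning

x+y≡0⇒y≡-x : ∀ {x y} → x + y ≡ 0ℚ → y ≡ - x
x+y≡0⇒y≡-x {x} {y} eq = begin
  y              ≡⟨ cancel x y ⟩
  (x + y) - x    ≡⟨ cong (_- x) eq ⟩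
  0ℚ - x         ≡⟨ +-identityˡ (- x) ⟩
  - x            ∎
  where
  open ≡-Reasoning
  cancel : ∀ x y → y ≡ (x + y) - x
  cancel = solve-∀ ℚ-ring

inv-inverseˡ : ∀ x (x≢0 : x ≢ 0ℚ) → inv x x≢0 * x ≡ 1ℚ
inv-inverseˡ x x≢0 = *-inverseˡ x {{≢-nonZero x≢0}}

inv-inverseʳ : ∀ x (x≢0 : x ≢ 0ℚ) → x * inv x x≢0 ≡ 1ℚ
inv-inverseʳ x x≢0 = trans (*-comm x (inv x x≢0)) (inv-inverseˡ x x≢0)

inv-unique : ∀ x (x≢0 : x ≢ 0ℚ) y → y * x ≡ 1ℚ → y ≡ inv x x≢0
inv-unique x x≢0 y yx≡1 = begin
  y                    ≡⟨ sym (*-identityʳ y) ⟩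
  y * 1ℚ               ≡⟨ cong (y *_) (sym (inv-inverseʳ x x≢0)) ⟩
  y * (x * inv x x≢0)  ≡⟨ sym (*-assoc y x _) ⟩
  (y * x) * inv x x≢0  ≡⟨ cong (_* inv x x≢0) yx≡1 ⟩
  1ℚ * inv x x≢0       ≡⟨ *-identityˡ _ ⟩
  inv x x≢0            ∎
  where open ≡-Reasoning

inv≢0 : ∀ x (x≢0 : x ≢ 0ℚ) → inv x x≢0 ≢ 0ℚ
inv≢0 x x≢0 eq with trans (sym (inv-inverseʳ x x≢0)) (trans (cong (x *_) eq) (*-zeroʳ x))
... | ()

inv-involutive : ∀ x (x≢0 : x ≢ 0ℚ) (x⁻¹≢0 : inv x x≢0 ≢ 0ℚ) → inv (inv x x≢0) x⁻¹≢0 ≡ x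
inv-involutive x x≢0 _ = 1/-involutive x {{≢-nonZero x≢0}}

neg≢0 : ∀ x → x ≢ 0ℚ → - x ≢ 0ℚ
neg≢0 x x≢0 eq = x≢0 (neg-injective eq)

inv-neg : ∀ x (x≢0 : x ≢ 0ℚ) (-x≢0 : - x ≢ 0ℚ) → inv (- x) -x≢0 ≡ - inv x x≢0
inv-neg x x≢0 -x≢0 = sym (inv-unique (- x) -x≢0 (- inv x x≢0)
  (trans (neg*neg (inv x x≢0) x) (inv-inverseˡ x x≢0)))
  where
  neg*neg : ∀ a b → (- a) * (- b) ≡ a * b
  neg*neg = solve-∀ ℚ-ring

*-1+inv : ∀ x (x≢0 : x ≢ 0ℚ) → x * (1ℚ + inv x x≢0) ≡ 1ℚ + x
*-1+inv x x≢0 = trans (expand x (inv x x≢0)) (cong (_+ x) (inv-inverseʳ x x≢0))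
  where
  expand : ∀ x y → x * (1ℚ + y) ≡ x * y + x
  expand = solve-∀ ℚ-ring

*-1-inv : ∀ x (x≢0 : x ≢ 0ℚ) → x * (1ℚ - inv x x≢0) ≡ x - 1ℚ
*-1-inv x x≢0 = trans (expand x (inv x x≢0)) (cong (λ t → x - t) (inv-inverseʳ x x≢0))
  where
  expand : ∀ x y → x * (1ℚ - y) ≡ x - x * y
  expand = solve-∀ ℚ-ring

pow≡^ : ∀ x n → pow x n ≡ x ^ n
pow≡^ x zero    = refl
pow≡^ x (suc n) = cong (x *_) (pow≡^ x n)

pow-+ : ∀ x m n → pow x (m ℕ.+ n) ≡ pow x m * pow x n
pow-+ x m n rewrite pow≡^ x (m ℕ.+ n) | pow≡^ x m | pow≡^ x n = ^-homo-* x m n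

pow-* : ∀ x y n → pow (x * y) n ≡ pow x n * pow y n
pow-* x y n rewrite pow≡^ (x * y) n | pow≡^ x n | pow≡^ y n = ^-distrib-* x y n

pow-1ℚ : ∀ n → pow 1ℚ n ≡ 1ℚ
pow-1ℚ zero    = refl
pow-1ℚ (suc n) = trans (cong (1ℚ *_) (pow-1ℚ n)) (*-identityˡ 1ℚ)

pow≢0 : ∀ x n → x ≢ 0ℚ → pow x n ≢ 0ℚ
pow≢0 x zero    x≢0 ()
pow≢0 x (suc n) x≢0 eq = pow≢0 x n x≢0 (x≢0∧x*y≡0⇒y≡0 x≢0 eq)

pow-pred : ∀ x {m} → 1 ≤ m → pow x m ≡ x * pow x (m ∸ 1)
pow-pred x {suc m} _ = refl

pow-split : ∀ x u m n {t} → m ℕ.+ n ≡ t → pow x t * pow u n ≡ pow x m * pow (x * u) n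
pow-split x u m n refl = begin
  pow x (m ℕ.+ n) * pow u n      ≡⟨ cong (_* pow u n) (pow-+ x m n) ⟩
  pow x m * pow x n * pow u n    ≡⟨ *-assoc (pow x m) _ _ ⟩
  pow x m * (pow x n * pow u n)  ≡⟨ cong (pow x m *_) (pow-* x u n) ⟨
  pow x m * pow (x * u) n        ∎
  where open ≡-Reasoning

pow-reflect : ∀ x (x≢0 : x ≢ 0ℚ) m n {t} → m ℕ.+ n ≡ t → pow x t * pow (inv x x≢0) n ≡ pow x m
pow-reflect x x≢0 m n {t} m+n≡t = begin
  pow x t * pow (inv x x≢0) n     ≡⟨ pow-split x (inv x x≢0) m n m+n≡t ⟩
  pow x m * pow (x * inv x x≢0) n ≡⟨ cong (λ t → pow x m * pow t n) (inv-inverseʳ x x≢0) ⟩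
  pow x m * pow 1ℚ n              ≡⟨ cong (pow x m *_) (pow-1ℚ n) ⟩
  pow x m * 1ℚ                    ≡⟨ *-identityʳ _ ⟩
  pow x m                         ∎
  where open ≡-Reasoning

pow-neg-even : ∀ x j → pow (- x) (2 ℕ.* j) ≡ pow x (2 ℕ.* j)
pow-neg-even x zero    = refl
pow-neg-even x (suc j) = begin
  pow (- x) (2 ℕ.* suc j)                 ≡⟨ cong (pow (- x)) (ℕ.*-suc 2 j) ⟩
  (- x) * ((- x) * pow (- x) (2 ℕ.* j))  ≡⟨ cong (λ t → (- x) * ((- x) * t)) (pow-neg-even x j) ⟩
  (- x) * ((- x) * pow x (2 ℕ.* j))      ≡⟨ neg*neg* x (pow x (2 ℕ.* j)) ⟩
  x * (x * pow x (2 ℕ.* j))              ≡⟨ cong (pow x) (ℕ.*-suc 2 j) ⟨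
  pow x (2 ℕ.* suc j)                     ∎
  where
  open ≡-Reasoning
  neg*neg* : ∀ a b → (- a) * ((- a) * b) ≡ a * (a * b)
  neg*neg* = solve-∀ ℚ-ring

pow-neg-odd : ∀ x j → pow (- x) (suc (2 ℕ.* j)) ≡ - pow x (suc (2 ℕ.* j))
pow-neg-odd x j = trans (cong ((- x) *_) (pow-neg-even x j)) (sym (neg-distribˡ-* x _))

∑ : ℕ → (ℕ → ℚ) → ℚ
∑ zero    F = 0ℚ
∑ (suc s) F = ∑ s F + F (suc s)

∑-cong : ∀ s {F G : ℕ → ℚ} → (∀ n → 1 ≤ n → n ≤ s → F n ≡ G n) → ∑ s F ≡ ∑ s G
∑-cong zero    F≡G = refl
∑-cong (suc s) F≡G = cong₂ _+_
  (∑-cong s (λ n 1≤n n≤s → F≡G n 1≤n (ℕ.m≤n⇒m≤1+n n≤s)))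
  (F≡G (suc s) (ℕ.s≤s ℕ.z≤n) ℕ.≤-refl)

∑-0 : ∀ s {F : ℕ → ℚ} → (∀ n → 1 ≤ n → n ≤ s → F n ≡ 0ℚ) → ∑ s F ≡ 0ℚ
∑-0 zero    F≡0 = refl
∑-0 (suc s) F≡0 = cong₂ _+_
  (∑-0 s (λ n 1≤n n≤s → F≡0 n 1≤n (ℕ.m≤n⇒m≤1+n n≤s)))
  (F≡0 (suc s) (ℕ.s≤s ℕ.z≤n) ℕ.≤-refl)

∑-+ : ∀ s (F G : ℕ → ℚ) → ∑ s (λ n → F n + G n) ≡ ∑ s F + ∑ s G
∑-+ zero    F G = refl
∑-+ (suc s) F G =
  trans (cong (_+ (F (suc s) + G (suc s))) (∑-+ s F G)) (interchange (∑ s F) (∑ s G) (F (suc s)) (G (suc s)))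
  where
  interchange : ∀ a b c d → (a + b) + (c + d) ≡ (a + c) + (b + d)
  interchange = solve-∀ ℚ-ring

∑-*ˡ : ∀ s a (F : ℕ → ℚ) → ∑ s (λ n → a * F n) ≡ a * ∑ s F
∑-*ˡ zero    a F = sym (*-zeroʳ a)
∑-*ˡ (suc s) a F =
  trans (cong (_+ a * F (suc s)) (∑-*ˡ s a F)) (sym (*-distribˡ-+ a _ _))

∑-neg : ∀ s (F : ℕ → ℚ) → ∑ s (λ n → - F n) ≡ - ∑ s F
∑-neg zero    F = refl
∑-neg (suc s) F =
  trans (cong (_+ - F (suc s)) (∑-neg s F)) (sym (neg-distrib-+ (∑ s F) (F (suc s))))

∑-- : ∀ s (F G : ℕ → ℚ) → ∑ s (λ n → F n - G n) ≡ ∑ s F - ∑ s G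
∑-- s F G = trans (∑-+ s F (λ n → - G n)) (cong (∑ s F +_) (∑-neg s G))

sumC≡∑ : ∀ c s x → sumC c s x ≡ ∑ s (λ n → c n * pow x (2 ℕ.* n))
sumC≡∑ c zero    x = refl
sumC≡∑ c (suc s) x = cong (_+ c (suc s) * pow x (2 ℕ.* suc s)) (sumC≡∑ c s x)

-- Polynomial arithmetic

infixl 6 _+ₚ_
infixr 7 _·ₚ_
infixl 6 _-ₚ_
infixl 7 _*ₚ_
infixr 8 _^ₚ_

_+ₚ_ : Poly → Poly → Poly
[]      +ₚ q       = q
(a ∷ p) +ₚ []      = a ∷ p
(a ∷ p) +ₚ (b ∷ q) = (a + b) ∷ (p +ₚ q)

_·ₚ_ : ℚ → Poly → Poly
c ·ₚ []      = []
c ·ₚ (a ∷ p) = c * a ∷ c ·ₚ p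

_-ₚ_ : Poly → Poly → Poly
p -ₚ q = p +ₚ (- 1ℚ) ·ₚ q

_*ₚ_ : Poly → Poly → Poly
[]      *ₚ q = []
(a ∷ p) *ₚ q = a ·ₚ q +ₚ (0ℚ ∷ p *ₚ q)

1ₚ : Poly
1ₚ = 1ℚ ∷ []

_^ₚ_ : Poly → ℕ → Poly
p ^ₚ zero  = 1ₚ
p ^ₚ suc n = p *ₚ p ^ₚ n

∑ₚ : ℕ → (ℕ → Poly) → Poly
∑ₚ zero    P = []
∑ₚ (suc s) P = ∑ₚ s P +ₚ P (suc s)

X : Poly
X = 0ℚ ∷ 1ℚ ∷ []

X+1 : Poly
X+1 = 1ℚ ∷ 1ℚ ∷ []

eval-const : ∀ a x → eval (a ∷ []) x ≡ a
eval-const a x = trans (cong (a +_) (*-zeroʳ x)) (+-identityʳ a)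

eval-+ₚ : ∀ p q x → eval (p +ₚ q) x ≡ eval p x + eval q x
eval-+ₚ []      q       x = sym (+-identityˡ (eval q x))
eval-+ₚ (a ∷ p) []      x = sym (+-identityʳ (eval (a ∷ p) x))
eval-+ₚ (a ∷ p) (b ∷ q) x = begin
  (a + b) + x * eval (p +ₚ q) x          ≡⟨ cong (λ t → (a + b) + x * t) (eval-+ₚ p q x) ⟩
  (a + b) + x * (eval p x + eval q x)    ≡⟨ regroup a b x (eval p x) (eval q x) ⟩
  (a + x * eval p x) + (b + x * eval q x) ∎
  where
  open ≡-Reasoning
  regroup : ∀ a b x u v → (a + b) + x * (u + v) ≡ (a + x * u) + (b + x * v)
  regroup = solve-∀ ℚ-ring

eval-·ₚ : ∀ c p x → eval (c ·ₚ p) x ≡ c * eval p x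
eval-·ₚ c []      x = sym (*-zeroʳ c)
eval-·ₚ c (a ∷ p) x =
  trans (cong (λ t → c * a + x * t) (eval-·ₚ c p x)) (regroup c a x (eval p x))
  where
  regroup : ∀ c a x u → c * a + x * (c * u) ≡ c * (a + x * u)
  regroup = solve-∀ ℚ-ring

eval-*ₚ : ∀ p q x → eval (p *ₚ q) x ≡ eval p x * eval q x
eval-*ₚ []      q x = sym (*-zeroˡ (eval q x))
eval-*ₚ (a ∷ p) q x = begin
  eval (a ·ₚ q +ₚ (0ℚ ∷ p *ₚ q)) x              ≡⟨ eval-+ₚ (a ·ₚ q) (0ℚ ∷ p *ₚ q) x ⟩
  eval (a ·ₚ q) x + (0ℚ + x * eval (p *ₚ q) x)  ≡⟨ cong₂ (λ u v → u + (0ℚ + x * v)) (eval-·ₚ a q x) (eval-*ₚ p q x) ⟩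
  a * eval q x + (0ℚ + x * (eval p x * eval q x)) ≡⟨ regroup a x (eval p x) (eval q x) ⟩
  (a + x * eval p x) * eval q x                 ∎
  where
  open ≡-Reasoning
  regroup : ∀ a x u v → a * v + (0ℚ + x * (u * v)) ≡ (a + x * u) * v
  regroup = solve-∀ ℚ-ring

eval-derivAux : ∀ k p x → eval (derivAux k p) x ≡ fromℕ k * eval p x + x * eval (deriv p) x
eval-derivAux k []       x = sym (regroup (fromℕ k) x)
  where
  regroup : ∀ a x → a * 0ℚ + x * 0ℚ ≡ 0ℚ
  regroup = solve-∀ ℚ-ring
eval-derivAux k (b ∷ bs) x = begin
  fromℕ k * b + x * eval (derivAux (suc k) bs) x
    ≡⟨ cong (λ t → fromℕ k * b + x * t) (eval-derivAux (suc k) bs x) ⟩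
  fromℕ k * b + x * (fromℕ (suc k) * eval bs x + x * eval (deriv bs) x)
    ≡⟨ cong (λ t → fromℕ k * b + x * (t * eval bs x + x * eval (deriv bs) x)) (fromℕ-suc k) ⟩
  fromℕ k * b + x * ((1ℚ + fromℕ k) * eval bs x + x * eval (deriv bs) x)
    ≡⟨ regroup (fromℕ k) b x (eval bs x) (eval (deriv bs) x) ⟩
  fromℕ k * (b + x * eval bs x) + x * (1ℚ * eval bs x + x * eval (deriv bs) x)
    ≡⟨ cong (λ t → fromℕ k * (b + x * eval bs x) + x * t) (eval-derivAux 1 bs x) ⟨
  fromℕ k * (b + x * eval bs x) + x * eval (derivAux 1 bs) x
    ∎
  where
  open ≡-Reasoning
  regroup : ∀ k b x u v → k * b + x * ((1ℚ + k) * u + x * v) ≡ k * (b + x * u) + x * (1ℚ * u + x * v)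
  regroup = solve-∀ ℚ-ring

deriv-∷ : ∀ a p x → eval (deriv (a ∷ p)) x ≡ eval p x + x * eval (deriv p) x
deriv-∷ a p x =
  trans (eval-derivAux 1 p x) (cong (_+ x * eval (deriv p) x) (*-identityˡ (eval p x)))

deriv-+ₚ : ∀ p q x → eval (deriv (p +ₚ q)) x ≡ eval (deriv p) x + eval (deriv q) x
deriv-+ₚ []      q       x = sym (+-identityˡ _)
deriv-+ₚ (a ∷ p) []      x = sym (+-identityʳ _)
deriv-+ₚ (a ∷ p) (b ∷ q) x = begin
  eval (deriv ((a + b) ∷ (p +ₚ q))) x
    ≡⟨ deriv-∷ (a + b) (p +ₚ q) x ⟩
  eval (p +ₚ q) x + x * eval (deriv (p +ₚ q)) x
    ≡⟨ cong₂ (λ u v → u + x * v) (eval-+ₚ p q x) (deriv-+ₚ p q x) ⟩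
  (eval p x + eval q x) + x * (eval (deriv p) x + eval (deriv q) x)
    ≡⟨ regroup x (eval p x) (eval q x) (eval (deriv p) x) (eval (deriv q) x) ⟩
  (eval p x + x * eval (deriv p) x) + (eval q x + x * eval (deriv q) x)
    ≡⟨ cong₂ _+_ (deriv-∷ a p x) (deriv-∷ b q x) ⟨
  eval (deriv (a ∷ p)) x + eval (deriv (b ∷ q)) x
    ∎
  where
  open ≡-Reasoning
  regroup : ∀ x u v u′ v′ → (u + v) + x * (u′ + v′) ≡ (u + x * u′) + (v + x * v′)
  regroup = solve-∀ ℚ-ring

deriv-·ₚ : ∀ c p x → eval (deriv (c ·ₚ p)) x ≡ c * eval (deriv p) x
deriv-·ₚ c []      x = sym (*-zeroʳ c)
deriv-·ₚ c (a ∷ p) x = begin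
  eval (deriv (c * a ∷ c ·ₚ p)) x                ≡⟨ deriv-∷ (c * a) (c ·ₚ p) x ⟩
  eval (c ·ₚ p) x + x * eval (deriv (c ·ₚ p)) x  ≡⟨ cong₂ (λ u v → u + x * v) (eval-·ₚ c p x) (deriv-·ₚ c p x) ⟩
  c * eval p x + x * (c * eval (deriv p) x)      ≡⟨ regroup c x (eval p x) (eval (deriv p) x) ⟩
  c * (eval p x + x * eval (deriv p) x)          ≡⟨ cong (c *_) (deriv-∷ a p x) ⟨
  c * eval (deriv (a ∷ p)) x                     ∎
  where
  open ≡-Reasoning
  regroup : ∀ c x u v → c * u + x * (c * v) ≡ c * (u + x * v)
  regroup = solve-∀ ℚ-ring

deriv-*ₚ : ∀ p q x →
  eval (deriv (p *ₚ q)) x ≡ eval (deriv p) x * eval q x + eval p x * eval (deriv q) x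
deriv-*ₚ []      q x = sym (regroup (eval q x) (eval (deriv q) x))
  where
  regroup : ∀ u v → 0ℚ * u + 0ℚ * v ≡ 0ℚ
  regroup = solve-∀ ℚ-ring
deriv-*ₚ (a ∷ p) q x = begin
  eval (deriv (a ·ₚ q +ₚ (0ℚ ∷ p *ₚ q))) x
    ≡⟨ deriv-+ₚ (a ·ₚ q) (0ℚ ∷ p *ₚ q) x ⟩
  eval (deriv (a ·ₚ q)) x + eval (deriv (0ℚ ∷ p *ₚ q)) x
    ≡⟨ cong₂ _+_ (deriv-·ₚ a q x) (deriv-∷ 0ℚ (p *ₚ q) x) ⟩
  a * Q′ + (eval (p *ₚ q) x + x * eval (deriv (p *ₚ q)) x)
    ≡⟨ cong₂ (λ u v → a * Q′ + (u + x * v)) (eval-*ₚ p q x) (deriv-*ₚ p q x) ⟩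
  a * Q′ + (P * Q + x * (P′ * Q + P * Q′))
    ≡⟨ regroup a x P Q P′ Q′ ⟩
  (P + x * P′) * Q + (a + x * P) * Q′
    ≡⟨ cong (λ t → t * Q + (a + x * P) * Q′) (deriv-∷ a p x) ⟨
  eval (deriv (a ∷ p)) x * Q + (a + x * P) * Q′
    ∎
  where
  open ≡-Reasoning
  P = eval p x
  Q = eval q x
  P′ = eval (deriv p) x
  Q′ = eval (deriv q) x
  regroup : ∀ a x P Q P′ Q′ →
    a * Q′ + (P * Q + x * (P′ * Q + P * Q′)) ≡ (P + x * P′) * Q + (a + x * P) * Q′
  regroup = solve-∀ ℚ-ring

record Realises (p : Poly) (f f′ : ℚ → ℚ) : Set where
  field
    eval≡  : ∀ x → eval p x ≡ f x
    deriv≡ : ∀ x → eval (deriv p) x ≡ f′ x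
open Realises

realises-ext : ∀ {p f f′ g g′} → (∀ x → f x ≡ g x) → (∀ x → f′ x ≡ g′ x) →
               Realises p f f′ → Realises p g g′
realises-ext f≡g f′≡g′ r = record
  { eval≡ = λ x → trans (eval≡ r x) (f≡g x) ; deriv≡ = λ x → trans (deriv≡ r x) (f′≡g′ x) }

realises-const : ∀ a → Realises (a ∷ []) (λ _ → a) (λ _ → 0ℚ)
realises-const a = record { eval≡ = eval-const a ; deriv≡ = λ _ → refl }

realises-+ₚ : ∀ {p q f f′ g g′} → Realises p f f′ → Realises q g g′ →
              Realises (p +ₚ q) (λ x → f x + g x) (λ x → f′ x + g′ x)
realises-+ₚ {p} {q} r s = record
  { eval≡  = λ x → trans (eval-+ₚ p q x) (cong₂ _+_ (eval≡ r x) (eval≡ s x))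
  ; deriv≡ = λ x → trans (deriv-+ₚ p q x) (cong₂ _+_ (deriv≡ r x) (deriv≡ s x)) }

realises-·ₚ : ∀ c {p f f′} → Realises p f f′ → Realises (c ·ₚ p) (λ x → c * f x) (λ x → c * f′ x)
realises-·ₚ c {p} r = record
  { eval≡  = λ x → trans (eval-·ₚ c p x) (cong (c *_) (eval≡ r x))
  ; deriv≡ = λ x → trans (deriv-·ₚ c p x) (cong (c *_) (deriv≡ r x)) }

realises--ₚ : ∀ {p q f f′ g g′} → Realises p f f′ → Realises q g g′ →
              Realises (p -ₚ q) (λ x → f x - g x) (λ x → f′ x - g′ x)
realises--ₚ {f = f} {f′} {g} {g′} r s =
  realises-ext (λ x → minus (f x) (g x)) (λ x → minus (f′ x) (g′ x)) (realises-+ₚ r (realises-·ₚ (- 1ℚ) s))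
  where
  minus : ∀ u v → u + (- 1ℚ) * v ≡ u - v
  minus = solve-∀ ℚ-ring

realises-*ₚ : ∀ {p q f f′ g g′} → Realises p f f′ → Realises q g g′ →
              Realises (p *ₚ q) (λ x → f x * g x) (λ x → f′ x * g x + f x * g′ x)
realises-*ₚ {p} {q} r s = record
  { eval≡  = λ x → trans (eval-*ₚ p q x) (cong₂ _*_ (eval≡ r x) (eval≡ s x))
  ; deriv≡ = λ x → trans (deriv-*ₚ p q x)
                     (cong₂ _+_ (cong₂ _*_ (deriv≡ r x) (eval≡ s x)) (cong₂ _*_ (eval≡ r x) (deriv≡ s x))) }

power-rule-step : ∀ n y d →
  d * pow y n + y * (fromℕ n * pow y (n ∸ 1) * d) ≡ fromℕ (suc n) * pow y n * d
power-rule-step zero    y d = regroup y d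
  where
  regroup : ∀ y d → d * 1ℚ + y * (0ℚ * 1ℚ * d) ≡ 1ℚ * 1ℚ * d
  regroup = solve-∀ ℚ-ring
power-rule-step (suc m) y d =
  trans (regroup d y (pow y m) (fromℕ (suc m))) (cong (λ t → t * (y * pow y m) * d) (sym (fromℕ-suc (suc m))))
  where
  regroup : ∀ d y P k → d * (y * P) + y * (k * P * d) ≡ (1ℚ + k) * (y * P) * d
  regroup = solve-∀ ℚ-ring

realises-^ₚ : ∀ {p f f′} → Realises p f f′ → ∀ n →
              Realises (p ^ₚ n) (λ x → pow (f x) n) (λ x → fromℕ n * pow (f x) (n ∸ 1) * f′ x)
realises-^ₚ {f = f} {f′} r zero =
  realises-ext (λ _ → refl) (λ x → sym (trans (cong (_* f′ x) (*-zeroˡ (pow (f x) 0))) (*-zeroˡ (f′ x))))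
    (realises-const 1ℚ)
realises-^ₚ {f = f} {f′} r (suc n) =
  realises-ext (λ _ → refl) (λ x → power-rule-step n (f x) (f′ x)) (realises-*ₚ r (realises-^ₚ r n))

realises-X : Realises X (λ x → x) (λ _ → 1ℚ)
realises-X = record { eval≡ = identity ; deriv≡ = eval-const (fromℕ 1 * 1ℚ) }
  where
  identity : ∀ x → 0ℚ + x * (1ℚ + x * 0ℚ) ≡ x
  identity = solve-∀ ℚ-ring

realises-X+1 : Realises X+1 (λ x → 1ℚ + x) (λ _ → 1ℚ)
realises-X+1 = record { eval≡ = identity ; deriv≡ = eval-const (fromℕ 1 * 1ℚ) }
  where
  identity : ∀ x → 1ℚ + x * (1ℚ + x * 0ℚ) ≡ 1ℚ + x
  identity = solve-∀ ℚ-ring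

realises-X^ : ∀ n → Realises (X ^ₚ n) (λ x → pow x n) (λ x → fromℕ n * pow x (n ∸ 1))
realises-X^ n = realises-ext (λ _ → refl) (λ x → *-identityʳ _) (realises-^ₚ realises-X n)

realises-X+1^ : ∀ n → Realises (X+1 ^ₚ n) (λ x → pow (1ℚ + x) n) (λ x → fromℕ n * pow (1ℚ + x) (n ∸ 1))
realises-X+1^ n = realises-ext (λ _ → refl) (λ x → *-identityʳ _) (realises-^ₚ realises-X+1 n)

realises-∑ₚ : ∀ {P : ℕ → Poly} {F F′ : ℕ → ℚ → ℚ} → (∀ n → Realises (P n) (F n) (F′ n)) →
              ∀ s → Realises (∑ₚ s P) (λ x → ∑ s (λ n → F n x)) (λ x → ∑ s (λ n → F′ n x))
realises-∑ₚ r zero    = record { eval≡ = λ _ → refl ; deriv≡ = λ _ → refl }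
realises-∑ₚ r (suc s) = realises-+ₚ (realises-∑ₚ r s) (r (suc s))

-- Polynomials vanishing on the positive integers

IsZero : Poly → Set
IsZero = All (_≡ 0ℚ)

eval-IsZero : ∀ {p} → IsZero p → ∀ x → eval p x ≡ 0ℚ
eval-IsZero All.[]           x = refl
eval-IsZero (a≡0 All.∷ p≡0) x =
  trans (cong₂ (λ u v → u + x * v) a≡0 (eval-IsZero p≡0 x)) (trans (+-identityˡ _) (*-zeroʳ x))

eval-at-0 : ∀ a p → eval (a ∷ p) 0ℚ ≡ a
eval-at-0 a p = trans (cong (a +_) (*-zeroˡ (eval p 0ℚ))) (+-identityʳ a)

IsZero-derivAux : ∀ k {p} → IsZero p → IsZero (derivAux k p)
IsZero-derivAux k All.[]           = All.[]
IsZero-derivAux k (a≡0 All.∷ p≡0) =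
  trans (cong (fromℕ k *_) a≡0) (*-zeroʳ (fromℕ k)) All.∷ IsZero-derivAux (suc k) p≡0

IsZero-deriv : ∀ {p} → IsZero p → IsZero (deriv p)
IsZero-deriv All.[]         = All.[]
IsZero-deriv (_ All.∷ p≡0) = IsZero-derivAux 1 p≡0

IsZero-derivAux⁻ : ∀ k p → IsZero (derivAux (suc k) p) → IsZero p
IsZero-derivAux⁻ k []      All.[]            = All.[]
IsZero-derivAux⁻ k (a ∷ p) (ka≡0 All.∷ p′≡0) =
  x≢0∧x*y≡0⇒y≡0 (fromℕ-suc≢0 k) ka≡0 All.∷ IsZero-derivAux⁻ (suc k) p p′≡0

IsZero-deriv⇒constant : ∀ p → IsZero (deriv p) → ∀ x → eval p x ≡ eval p 0ℚ
IsZero-deriv⇒constant []      _    x = refl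
IsZero-deriv⇒constant (a ∷ p) p′≡0 x = begin
  a + x * eval p x  ≡⟨ cong (λ t → a + x * t) (eval-IsZero p≡0 x) ⟩
  a + x * 0ℚ        ≡⟨ cong (a +_) (*-zeroʳ x) ⟩
  a + 0ℚ            ≡⟨ cong (a +_) (*-zeroˡ (eval p 0ℚ)) ⟨
  a + 0ℚ * eval p 0ℚ ∎
  where
  open ≡-Reasoning
  p≡0 = IsZero-derivAux⁻ 0 p p′≡0

-- divide r p is the quotient of a ∷ p by X - r, whatever the constant term a.
divide : ℚ → Poly → Poly
divide r []      = []
divide r (b ∷ p) = eval (b ∷ p) r ∷ divide r p

length-divide : ∀ r p → length (divide r p) ≡ length p
length-divide r []      = refl
length-divide r (b ∷ p) = cong suc (length-divide r p)

eval-divide : ∀ r a p x → eval (a ∷ p) x ≡ (x - r) * eval (divide r p) x + eval (a ∷ p) r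
eval-divide r a []      x = regroup a x r
  where
  regroup : ∀ a x r → a + x * 0ℚ ≡ (x - r) * 0ℚ + (a + r * 0ℚ)
  regroup = solve-∀ ℚ-ring
eval-divide r a (b ∷ p) x =
  trans (cong (λ t → a + x * t) (eval-divide r b p x))
        (regroup a x r (eval (divide r p) x) (eval (b ∷ p) r))
  where
  regroup : ∀ a x r d v → a + x * ((x - r) * d + v) ≡ (x - r) * (v + x * d) + (a + r * v)
  regroup = solve-∀ ℚ-ring

IsZero-divide : ∀ r a p → IsZero (divide r p) → eval (a ∷ p) r ≡ 0ℚ → IsZero (a ∷ p)
IsZero-divide r a []      All.[]               p[r]≡0 =
  trans (sym (eval-const a r)) p[r]≡0 All.∷ All.[]
IsZero-divide r a (b ∷ p) (q[r]≡0 All.∷ d≡0) p[r]≡0 =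
  a≡0 All.∷ IsZero-divide r b p d≡0 q[r]≡0
  where
  a≡0 : a ≡ 0ℚ
  a≡0 = begin
    a                   ≡⟨ +-identityʳ a ⟨
    a + 0ℚ              ≡⟨ cong (a +_) (*-zeroʳ r) ⟨
    a + r * 0ℚ          ≡⟨ cong (λ t → a + r * t) q[r]≡0 ⟨
    eval (a ∷ b ∷ p) r  ≡⟨ p[r]≡0 ⟩
    0ℚ                  ∎
    where open ≡-Reasoning

-- Induction on the degree: a root r = m + 1 splits off a factor X - r,
-- and the quotient vanishes at the integers beyond r.
vanishing-beyond⇒IsZero : ∀ l p m → length p ≡ l →
  (∀ n → eval p (fromℕ (suc (n ℕ.+ m))) ≡ 0ℚ) → IsZero p
vanishing-beyond⇒IsZero l       []      m _   _    = All.[]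
vanishing-beyond⇒IsZero (suc l) (a ∷ p) m len p≡0 =
  IsZero-divide r a p
    (vanishing-beyond⇒IsZero l (divide r p) (suc m) (trans (length-divide r p) (ℕ.suc-injective len)) d≡0)
    (p≡0 0)
  where
  r = fromℕ (suc m)
  d≡0 : ∀ n → eval (divide r p) (fromℕ (suc (n ℕ.+ suc m))) ≡ 0ℚ
  d≡0 n = x≢0∧x*y≡0⇒y≡0 x-r≢0 (begin
    (x - r) * eval (divide r p) x             ≡⟨ +-identityʳ _ ⟨
    (x - r) * eval (divide r p) x + 0ℚ        ≡⟨ cong ((x - r) * eval (divide r p) x +_) (p≡0 0) ⟨
    (x - r) * eval (divide r p) x + eval (a ∷ p) r ≡⟨ eval-divide r a p x ⟨
    eval (a ∷ p) x                             ≡⟨ cong (λ t → eval (a ∷ p) (fromℕ (suc t))) (ℕ.+-suc n m) ⟩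
    eval (a ∷ p) (fromℕ (suc (suc n ℕ.+ m)))  ≡⟨ p≡0 (suc n) ⟩
    0ℚ                                         ∎)
    where
    open ≡-Reasoning
    x = fromℕ (suc (n ℕ.+ suc m))
    x-r≢0 : x - r ≢ 0ℚ
    x-r≢0 eq = fromℕ-suc≢0 n (begin
      fromℕ (suc n)                       ≡⟨ cancel (fromℕ (suc n)) r ⟩
      (fromℕ (suc n) + r) - r             ≡⟨ cong (_- r) (fromℕ-+ (suc n) (suc m)) ⟨
      fromℕ (suc n ℕ.+ suc m) - r         ≡⟨ eq ⟩
      0ℚ                                  ∎)
      where
      cancel : ∀ a b → a ≡ (a + b) - b
      cancel = solve-∀ ℚ-ring

vanishing⇒IsZero : ∀ p → (∀ n → eval p (fromℕ (suc n)) ≡ 0ℚ) → IsZero p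
vanishing⇒IsZero p p≡0 =
  vanishing-beyond⇒IsZero (length p) p 0 refl
    (λ n → trans (cong (λ t → eval p (fromℕ (suc t))) (ℕ.+-identityʳ n)) (p≡0 n))

vanishing⇒deriv≡0 : ∀ {p f f′} → Realises p f f′ →
  (∀ n → f (fromℕ (suc n)) ≡ 0ℚ) → ∀ x → f′ x ≡ 0ℚ
vanishing⇒deriv≡0 {p} r f≡0 x =
  trans (sym (deriv≡ r x)) (eval-IsZero (IsZero-deriv (vanishing⇒IsZero p p≡0)) x)
  where
  p≡0 : ∀ n → eval p (fromℕ (suc n)) ≡ 0ℚ
  p≡0 n = trans (eval≡ r _) (f≡0 n)

same-derivative⇒same-increment : ∀ {p q f f′ g g′} → Realises p f f′ → Realises q g g′ →
  (∀ n → f′ (fromℕ (suc n)) ≡ g′ (fromℕ (suc n))) → ∀ x → f x - g x ≡ f 0ℚ - g 0ℚ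
same-derivative⇒same-increment {p} {q} {f} {f′} {g} {g′} r s f′≡g′ x = begin
  f x - g x          ≡⟨ eval≡ difference x ⟨
  eval d x           ≡⟨ IsZero-deriv⇒constant d (vanishing⇒IsZero (deriv d) d′≡0) x ⟩
  eval d 0ℚ          ≡⟨ eval≡ difference 0ℚ ⟩
  f 0ℚ - g 0ℚ        ∎
  where
  open ≡-Reasoning
  d = p -ₚ q
  difference : Realises d (λ x → f x - g x) (λ x → f′ x - g′ x)
  difference = realises--ₚ r s
  d′≡0 : ∀ n → eval (deriv d) (fromℕ (suc n)) ≡ 0ℚ
  d′≡0 n = trans (deriv≡ difference _) (trans (cong (_- g′ _) (f′≡g′ n)) (+-inverseʳ (g′ (fromℕ (suc n)))))

-- odeₚ w 0 ψ is (1 + X) ψ′ - w ψ; k is the index of the first coefficient of ψ.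
odeₚ : ℚ → ℕ → Poly → Poly
odeₚ w k []          = []
odeₚ w k (a ∷ [])    = fromℕ k * a - w * a ∷ []
odeₚ w k (a ∷ b ∷ p) = fromℕ (suc k) * b + fromℕ k * a - w * a ∷ odeₚ w (suc k) (b ∷ p)

eval-odeₚ : ∀ w k a p x → eval (odeₚ w k (a ∷ p)) x ≡
  eval (derivAux (suc k) p) x + eval (derivAux k (a ∷ p)) x - w * eval (a ∷ p) x
eval-odeₚ w k a []      x = regroup (fromℕ k) a w x
  where
  regroup : ∀ k a w x → (k * a - w * a) + x * 0ℚ ≡ 0ℚ + (k * a + x * 0ℚ) - w * (a + x * 0ℚ)
  regroup = solve-∀ ℚ-ring
eval-odeₚ w k a (b ∷ p) x =
  trans (cong (λ t → fromℕ (suc k) * b + fromℕ k * a - w * a + x * t) (eval-odeₚ w (suc k) b p x))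
        (regroup (fromℕ (suc k)) (fromℕ k) a b w x
          (eval (derivAux (suc (suc k)) p) x) (eval (derivAux (suc k) (b ∷ p)) x) (eval p x))
  where
  regroup : ∀ k₁ k a b w x D₂ D₁ E →
    (k₁ * b + k * a - w * a) + x * (D₂ + D₁ - w * (b + x * E))
      ≡ (k₁ * b + x * D₂) + (k * a + x * D₁) - w * (a + x * (b + x * E))
  regroup = solve-∀ ℚ-ring

eval-odeₚ-0 : ∀ w ψ x → eval (odeₚ w 0 ψ) x ≡ (1ℚ + x) * eval (deriv ψ) x - w * eval ψ x
eval-odeₚ-0 w []      x = sym (regroup w x)
  where
  regroup : ∀ w x → (1ℚ + x) * 0ℚ - w * 0ℚ ≡ 0ℚ
  regroup = solve-∀ ℚ-ring
eval-odeₚ-0 w (a ∷ p) x = begin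
  eval (odeₚ w 0 (a ∷ p)) x                ≡⟨ eval-odeₚ w 0 a p x ⟩
  ψ′ + eval (derivAux 0 (a ∷ p)) x - w * ψ ≡⟨ cong (λ t → ψ′ + t - w * ψ) (eval-derivAux 0 (a ∷ p) x) ⟩
  ψ′ + (0ℚ * ψ + x * ψ′) - w * ψ          ≡⟨ regroup ψ′ x ψ w ⟩
  (1ℚ + x) * ψ′ - w * ψ                    ∎
  where
  open ≡-Reasoning
  ψ = eval (a ∷ p) x
  ψ′ = eval (deriv (a ∷ p)) x
  regroup : ∀ d x e w → d + (0ℚ * e + x * d) - w * e ≡ (1ℚ + x) * d - w * e
  regroup = solve-∀ ℚ-ring

IsZero-odeₚ : ∀ w k a p → IsZero (odeₚ w k (a ∷ p)) → a ≡ 0ℚ → IsZero (a ∷ p)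
IsZero-odeₚ w k a []      _                a≡0 = a≡0 All.∷ All.[]
IsZero-odeₚ w k a (b ∷ p) (c≡0 All.∷ cs≡0) a≡0 = a≡0 All.∷ IsZero-odeₚ w (suc k) b p cs≡0 b≡0
  where
  drop-a : ∀ u k w → u + k * 0ℚ - w * 0ℚ ≡ u
  drop-a = solve-∀ ℚ-ring
  b≡0 : b ≡ 0ℚ
  b≡0 = x≢0∧x*y≡0⇒y≡0 (fromℕ-suc≢0 k) (begin
    fromℕ (suc k) * b                                    ≡⟨ drop-a _ (fromℕ k) w ⟨
    fromℕ (suc k) * b + fromℕ k * 0ℚ - w * 0ℚ            ≡⟨ cong (λ t → fromℕ (suc k) * b + fromℕ k * t - w * t) a≡0 ⟨
    fromℕ (suc k) * b + fromℕ k * a - w * a              ≡⟨ c≡0 ⟩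
    0ℚ                                                   ∎)
    where open ≡-Reasoning

ode-uniqueness : ∀ w {ψ f f′} → Realises ψ f f′ →
  (∀ n → (1ℚ + fromℕ (suc n)) * f′ (fromℕ (suc n)) - w * f (fromℕ (suc n)) ≡ 0ℚ) →
  f 0ℚ ≡ 0ℚ → ∀ x → f x ≡ 0ℚ
ode-uniqueness w {[]}    r _      _    x = trans (sym (eval≡ r x)) refl
ode-uniqueness w {a ∷ p} r ode≡0 f0≡0 x =
  trans (sym (eval≡ r x)) (eval-IsZero (IsZero-odeₚ w 0 a p (vanishing⇒IsZero _ odeₚ≡0) a≡0) x)
  where
  a≡0 : a ≡ 0ℚ
  a≡0 = trans (sym (eval-at-0 a p)) (trans (eval≡ r 0ℚ) f0≡0)
  odeₚ≡0 : ∀ n → eval (odeₚ w 0 (a ∷ p)) (fromℕ (suc n)) ≡ 0ℚ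
  odeₚ≡0 n = trans (eval-odeₚ-0 w (a ∷ p) y)
               (trans (cong₂ (λ u v → (1ℚ + y) * u - w * v) (deriv≡ r y) (eval≡ r y)) (ode≡0 n))
    where y = fromℕ (suc n)

-- Reciprocal functions

reciprocal-inverse : ∀ d (F G : ℚ → ℚ) →
  (∀ x (x≢0 : x ≢ 0ℚ) → F x ≡ pow x d * G (inv x x≢0)) →
  ∀ y (y≢0 : y ≢ 0ℚ) → G y ≡ pow y d * F (inv y y≢0)
reciprocal-inverse d F G F≡ y y≢0 = begin
  G y                          ≡⟨ *-identityˡ (G y) ⟨
  1ℚ * G y                     ≡⟨ cong (_* G y) (pow-reflect y y≢0 0 d refl) ⟨
  pow y d * pow y⁻¹ d * G y    ≡⟨ *-assoc (pow y d) _ _ ⟩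
  pow y d * (pow y⁻¹ d * G y)  ≡⟨ cong (λ t → pow y d * (pow y⁻¹ d * G t)) (inv-involutive y y≢0 y⁻¹≢0) ⟨
  pow y d * (pow y⁻¹ d * G (inv y⁻¹ y⁻¹≢0)) ≡⟨ cong (pow y d *_) (F≡ y⁻¹ y⁻¹≢0) ⟨
  pow y d * F y⁻¹              ∎
  where
  open ≡-Reasoning
  y⁻¹ = inv y y≢0
  y⁻¹≢0 = inv≢0 y y≢0

reciprocity-pair⇒P*v≡k : ∀ k u v P → k + u ≡ P * (k + v) → k - u ≡ (- P) * (k - v) → P * v ≡ k
reciprocity-pair⇒P*v≡k k u v P at-x at-−x = x-y≡0⇒x≡y (x≢0∧x*y≡0⇒y≡0 {1ℚ + 1ℚ} (λ ()) (begin
  (1ℚ + 1ℚ) * (P * v - k)                               ≡⟨ sum-of-both k u P v ⟩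
  (P * (k + v) + (- P) * (k - v)) - (k + u) - (k - u)   ≡⟨ cong₂ (λ a b → (a + b) - (k + u) - (k - u)) at-x at-−x ⟨
  ((k + u) + (k - u)) - (k + u) - (k - u)               ≡⟨ cancels (k + u) (k - u) ⟩
  0ℚ                                                    ∎))
  where
  open ≡-Reasoning
  sum-of-both : ∀ k u P v → (1ℚ + 1ℚ) * (P * v - k) ≡ (P * (k + v) + (- P) * (k - v)) - (k + u) - (k - u)
  sum-of-both = solve-∀ ℚ-ring
  cancels : ∀ a b → (a + b) - a - b ≡ 0ℚ
  cancels = solve-∀ ℚ-ring

-- Adding the reciprocity relation at x and at -x cancels the odd part.
reciprocal+odd⇒explicit : ∀ j (m o : ℚ → ℚ) k → (∀ x → o (- x) ≡ - o x) →
  (∀ x (x≢0 : x ≢ 0ℚ) → m x ≡ pow x (suc (2 ℕ.* j)) * m (inv x x≢0)) →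
  (∀ x → x ≢ 0ℚ → m x ≡ k + o x) →
  ∀ x → x ≢ 0ℚ → m x ≡ k + k * pow x (suc (2 ℕ.* j))
reciprocal+odd⇒explicit j m o k o-odd m-recip m≡k+o x x≢0 = begin
  m x             ≡⟨ m-recip x x≢0 ⟩
  P * m y         ≡⟨ cong (P *_) (m≡k+o y y≢0) ⟩
  P * (k + o y)   ≡⟨ *-distribˡ-+ P k (o y) ⟩
  P * k + P * o y ≡⟨ cong (P * k +_) (reciprocity-pair⇒P*v≡k k (o x) (o y) P at-x at-−x) ⟩
  P * k + k       ≡⟨ +-comm (P * k) k ⟩
  k + P * k       ≡⟨ cong (k +_) (*-comm P k) ⟩
  k + k * P       ∎
  where
  open ≡-Reasoning
  d = suc (2 ℕ.* j)
  P = pow x d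
  y = inv x x≢0
  y≢0 = inv≢0 x x≢0
  -x≢0 = neg≢0 x x≢0
  at-x : k + o x ≡ P * (k + o y)
  at-x = trans (sym (m≡k+o x x≢0)) (trans (m-recip x x≢0) (cong (P *_) (m≡k+o y y≢0)))
  at-−x : k - o x ≡ (- P) * (k - o y)
  at-−x = begin
    k - o x                          ≡⟨ cong (k +_) (o-odd x) ⟨
    k + o (- x)                      ≡⟨ m≡k+o (- x) -x≢0 ⟨
    m (- x)                          ≡⟨ m-recip (- x) -x≢0 ⟩
    pow (- x) d * m (inv (- x) -x≢0) ≡⟨ cong₂ (λ a b → a * m b) (pow-neg-odd x j) (inv-neg x x≢0 -x≢0) ⟩
    (- P) * m (- y)                  ≡⟨ cong ((- P) *_) (m≡k+o (- y) (neg≢0 y y≢0)) ⟩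
    (- P) * (k + o (- y))            ≡⟨ cong (λ t → (- P) * (k + t)) (o-odd y) ⟩
    (- P) * (k - o y)                ∎

module Proof (s : ℕ) (c : ℕ → ℚ) (q : Poly) (k : ℚ) (o : Poly) (o-odd : IsOddPoly o)
  (C-relation : ∀ x (x≢0 : x ≢ 0ℚ) → sumC c s x - sumC c s (1ℚ + x)
      - pow x (suc (2 ℕ.* s)) * sumC c s (1ℚ + inv x x≢0) ≡ k + eval o x)
  (C≡q′ : ∀ x (x≢0 : x ≢ 0ℚ) → sumC c s x ≡ pow x (suc (2 ℕ.* s)) * eval (deriv q) (inv x x≢0))
  (q-recip : ∀ x (x≢0 : x ≢ 0ℚ) → eval q x + pow x (suc (suc (2 ℕ.* s))) * eval q (inv x x≢0) ≡ 0ℚ)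
  (q0≡0 : eval q 0ℚ ≡ 0ℚ) where

  w : ℕ
  w = suc (suc (2 ℕ.* s))

  w₁ : ℕ
  w₁ = suc (2 ℕ.* s)

  -- For 1 ≤ n ≤ s the monomial c n X^(β n) of C corresponds to the monomial b n X^(α n) of q,
  -- and α n + β n = w.
  α : ℕ → ℕ
  α n = suc (suc (2 ℕ.* (s ∸ n)))

  α′ : ℕ → ℕ
  α′ n = suc (2 ℕ.* (s ∸ n))

  β : ℕ → ℕ
  β n = 2 ℕ.* n

  β′ : ℕ → ℕ
  β′ n = β n ∸ 1

  2[s∸n]+2n≡2s : ∀ {n} → n ≤ s → 2 ℕ.* (s ∸ n) ℕ.+ 2 ℕ.* n ≡ 2 ℕ.* s
  2[s∸n]+2n≡2s {n} n≤s = trans (sym (ℕ.*-distribˡ-+ 2 (s ∸ n) n)) (cong (2 ℕ.*_) (ℕ.m∸n+n≡m n≤s))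

  α+β≡w : ∀ {n} → n ≤ s → α n ℕ.+ β n ≡ w
  α+β≡w n≤s = cong (λ m → suc (suc m)) (2[s∸n]+2n≡2s n≤s)

  α′+β≡w₁ : ∀ {n} → n ≤ s → α′ n ℕ.+ β n ≡ w₁
  α′+β≡w₁ n≤s = cong suc (2[s∸n]+2n≡2s n≤s)

  1≤β : ∀ {n} → 1 ≤ n → 1 ≤ β n
  1≤β {n} 1≤n = ℕ.≤-trans 1≤n (ℕ.m≤n*m n 2)

  α+β′≡w₁ : ∀ {n} → 1 ≤ n → n ≤ s → α n ℕ.+ β′ n ≡ w₁
  α+β′≡w₁ {n} 1≤n n≤s = trans (sym (ℕ.+-∸-assoc (α n) (1≤β 1≤n))) (cong (_∸ 1) (α+β≡w n≤s))

  b : ℕ → ℚ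
  b n = c n * inv (fromℕ (α n)) (fromℕ-suc≢0 (α′ n))

  b*α≡c : ∀ n → b n * fromℕ (α n) ≡ c n
  b*α≡c n = trans (*-assoc (c n) _ _)
    (trans (cong (c n *_) (inv-inverseˡ (fromℕ (α n)) (fromℕ-suc≢0 (α′ n)))) (*-identityʳ (c n)))

  C : ℚ → ℚ
  C = sumC c s

  C≡∑ : ∀ x → C x ≡ ∑ s (λ n → c n * pow x (β n))
  C≡∑ = sumC≡∑ c s

  Q : ℚ → ℚ
  Q y = ∑ s (λ n → b n * pow y (α n))

  Q′ : ℚ → ℚ
  Q′ y = ∑ s (λ n → c n * pow y (α′ n))

  Qₚ : Poly
  Qₚ = ∑ₚ s (λ n → b n ·ₚ X ^ₚ α n)

  realises-Q : Realises Qₚ Q Q′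
  realises-Q = realises-ext (λ _ → refl) (λ y → ∑-cong s (λ n _ _ → b*[α*P]≡c*P n (pow y (α′ n))))
                 (realises-∑ₚ (λ n → realises-·ₚ (b n) (realises-X^ (α n))) s)
    where
    b*[α*P]≡c*P : ∀ n P → b n * (fromℕ (α n) * P) ≡ c n * P
    b*[α*P]≡c*P n P = trans (sym (*-assoc (b n) _ P)) (cong (_* P) (b*α≡c n))

  q′≡Q′ : ∀ y → y ≢ 0ℚ → eval (deriv q) y ≡ Q′ y
  q′≡Q′ y y≢0 = begin
    eval (deriv q) y                               ≡⟨ reciprocal-inverse w₁ C (eval (deriv q)) C≡q′ y y≢0 ⟩
    pow y w₁ * C y⁻¹                               ≡⟨ cong (pow y w₁ *_) (C≡∑ y⁻¹) ⟩
    pow y w₁ * ∑ s (λ n → c n * pow y⁻¹ (β n))     ≡⟨ ∑-*ˡ s (pow y w₁) _ ⟨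
    ∑ s (λ n → pow y w₁ * (c n * pow y⁻¹ (β n)))   ≡⟨ ∑-cong s term ⟩
    Q′ y                                           ∎
    where
    open ≡-Reasoning
    y⁻¹ = inv y y≢0
    term : ∀ n → 1 ≤ n → n ≤ s → pow y w₁ * (c n * pow y⁻¹ (β n)) ≡ c n * pow y (α′ n)
    term n _ n≤s = trans (x∙yz≈y∙xz (pow y w₁) (c n) _)
                         (cong (c n *_) (pow-reflect y y≢0 (α′ n) (β n) (α′+β≡w₁ n≤s)))

  q≡Q : ∀ y → eval q y ≡ Q y
  q≡Q y = x-y≡0⇒x≡y (begin
    eval q y - Q y    ≡⟨ same-derivative⇒same-increment q-realised realises-Q q′≡Q′-on-ℕ⁺ y ⟩
    eval q 0ℚ - Q 0ℚ  ≡⟨ cong₂ _-_ q0≡0 Q0≡0 ⟩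
    0ℚ - 0ℚ           ≡⟨⟩
    0ℚ                ∎)
    where
    open ≡-Reasoning
    q-realised : Realises q (eval q) (eval (deriv q))
    q-realised = record { eval≡ = λ _ → refl ; deriv≡ = λ _ → refl }
    q′≡Q′-on-ℕ⁺ : ∀ n → eval (deriv q) (fromℕ (suc n)) ≡ Q′ (fromℕ (suc n))
    q′≡Q′-on-ℕ⁺ n = q′≡Q′ _ (fromℕ-suc≢0 n)
    Q0≡0 : Q 0ℚ ≡ 0ℚ
    Q0≡0 = ∑-0 s (λ n _ _ → trans (cong (b n *_) (*-zeroˡ (pow 0ℚ (α′ n)))) (*-zeroʳ (b n)))

  pow-neg-α : ∀ y n → pow (- y) (α n) ≡ pow y (α n)
  pow-neg-α y n = trans (cong ((- y) *_) (pow-neg-odd y (s ∸ n))) (neg*neg y (pow y (α′ n)))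
    where
    neg*neg : ∀ a b → (- a) * (- b) ≡ a * b
    neg*neg = solve-∀ ℚ-ring

  A : ℚ → ℚ
  A y = ∑ s (λ n → b n * (pow y (α n) + pow y (β n)))

  A′ₙ : ℕ → ℚ → ℚ
  A′ₙ n y = b n * (fromℕ (α n) * pow y (α′ n) + fromℕ (β n) * pow y (β′ n))

  A′ : ℚ → ℚ
  A′ y = ∑ s (λ n → A′ₙ n y)

  realises-A : Realises (∑ₚ s (λ n → b n ·ₚ (X ^ₚ α n +ₚ X ^ₚ β n))) A A′
  realises-A = realises-∑ₚ (λ n → realises-·ₚ (b n) (realises-+ₚ (realises-X^ (α n)) (realises-X^ (β n)))) s

  A≡0 : ∀ y → y ≢ 0ℚ → A y ≡ 0ℚ
  A≡0 y y≢0 = begin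
    A y                                                   ≡⟨ ∑-cong s (λ n _ _ → *-distribˡ-+ (b n) _ _) ⟩
    ∑ s (λ n → b n * pow y (α n) + b n * pow y (β n))     ≡⟨ ∑-+ s _ _ ⟩
    Q y + ∑ s (λ n → b n * pow y (β n))                   ≡⟨ cong (Q y +_) (∑-cong s term) ⟨
    Q y + ∑ s (λ n → pow y w * (b n * pow y⁻¹ (α n)))    ≡⟨ cong (Q y +_) (∑-*ˡ s (pow y w) _) ⟩
    Q y + pow y w * Q y⁻¹                                 ≡⟨ cong₂ (λ u v → u + pow y w * v) (q≡Q y) (q≡Q y⁻¹) ⟨
    eval q y + pow y w * eval q y⁻¹                       ≡⟨ q-recip y y≢0 ⟩
    0ℚ                                                    ∎
    where
    open ≡-Reasoning
    y⁻¹ = inv y y≢0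
    term : ∀ n → 1 ≤ n → n ≤ s → pow y w * (b n * pow y⁻¹ (α n)) ≡ b n * pow y (β n)
    term n _ n≤s = trans (x∙yz≈y∙xz (pow y w) (b n) _)
      (cong (b n *_) (pow-reflect y y≢0 (β n) (α n) (trans (ℕ.+-comm (β n) (α n)) (α+β≡w n≤s))))

  A′≡0 : ∀ y → A′ y ≡ 0ℚ
  A′≡0 = vanishing⇒deriv≡0 realises-A (λ n → A≡0 _ (fromℕ-suc≢0 n))

  Rₙ : ℕ → ℚ → ℚ
  Rₙ n y = c n * pow y (β n) + fromℕ (β n) * b n * pow y (α n)

  R : ℚ → ℚ
  R y = ∑ s (λ n → Rₙ n y)

  A′ₙ-reflected : ∀ y (y≢0 : y ≢ 0ℚ) n → 1 ≤ n → n ≤ s →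
    pow y w₁ * A′ₙ n (inv y y≢0) ≡ Rₙ n y
  A′ₙ-reflected y y≢0 n 1≤n n≤s = begin
    pow y w₁ * (b n * (fromℕ (α n) * pow y⁻¹ (α′ n) + fromℕ (β n) * pow y⁻¹ (β′ n)))
      ≡⟨ regroup (pow y w₁) (b n) (fromℕ (α n)) (fromℕ (β n)) (pow y⁻¹ (α′ n)) (pow y⁻¹ (β′ n)) ⟩
    (b n * fromℕ (α n)) * (pow y w₁ * pow y⁻¹ (α′ n)) + fromℕ (β n) * b n * (pow y w₁ * pow y⁻¹ (β′ n))
      ≡⟨ cong₂ (λ u v → u * v + fromℕ (β n) * b n * (pow y w₁ * pow y⁻¹ (β′ n))) (b*α≡c n)
           (pow-reflect y y≢0 (β n) (α′ n) (trans (ℕ.+-comm (β n) (α′ n)) (α′+β≡w₁ n≤s))) ⟩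
    c n * pow y (β n) + fromℕ (β n) * b n * (pow y w₁ * pow y⁻¹ (β′ n))
      ≡⟨ cong (λ v → c n * pow y (β n) + fromℕ (β n) * b n * v) (pow-reflect y y≢0 (α n) (β′ n) (α+β′≡w₁ 1≤n n≤s)) ⟩
    c n * pow y (β n) + fromℕ (β n) * b n * pow y (α n)
      ∎
    where
    open ≡-Reasoning
    y⁻¹ = inv y y≢0
    regroup : ∀ Y b a e P₁ P₂ → Y * (b * (a * P₁ + e * P₂)) ≡ (b * a) * (Y * P₁) + e * b * (Y * P₂)
    regroup = solve-∀ ℚ-ring

  R≡0 : ∀ y → y ≢ 0ℚ → R y ≡ 0ℚ
  R≡0 y y≢0 = begin
    R y                                        ≡⟨ ∑-cong s (A′ₙ-reflected y y≢0) ⟨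
    ∑ s (λ n → pow y w₁ * A′ₙ n (inv y y≢0))   ≡⟨ ∑-*ˡ s (pow y w₁) _ ⟩
    pow y w₁ * A′ (inv y y≢0)                  ≡⟨ cong (pow y w₁ *_) (A′≡0 (inv y y≢0)) ⟩
    pow y w₁ * 0ℚ                              ≡⟨ *-zeroʳ (pow y w₁) ⟩
    0ℚ                                         ∎
    where open ≡-Reasoning

  fₙ : ℕ → ℚ → ℚ
  fₙ n x = b n * ((pow x (α n) - pow (1ℚ + x) (α n)) - pow x (α n) * pow (1ℚ + x) (β n))

  f′ₙ : ℕ → ℚ → ℚ
  f′ₙ n x = b n * ((fromℕ (α n) * pow x (α′ n) - fromℕ (α n) * pow (1ℚ + x) (α′ n))
    - (fromℕ (α n) * pow x (α′ n) * pow (1ℚ + x) (β n) + pow x (α n) * (fromℕ (β n) * pow (1ℚ + x) (β′ n))))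

  -- f x = Q x - Q (1 + x) - (1 + x)^w Q (x / (1 + x)).
  f : ℚ → ℚ
  f x = ∑ s (λ n → fₙ n x)

  f′ : ℚ → ℚ
  f′ x = ∑ s (λ n → f′ₙ n x)

  fₚ : Poly
  fₚ = ∑ₚ s (λ n → b n ·ₚ ((X ^ₚ α n -ₚ X+1 ^ₚ α n) -ₚ X ^ₚ α n *ₚ X+1 ^ₚ β n))

  realises-f : Realises fₚ f f′
  realises-f = realises-∑ₚ (λ n → realises-·ₚ (b n)
    (realises--ₚ (realises--ₚ (realises-X^ (α n)) (realises-X+1^ (α n)))
                 (realises-*ₚ (realises-X^ (α n)) (realises-X+1^ (β n))))) s

  Gₙ : ℕ → ℚ → ℚ
  Gₙ n x = c n * ((pow x (β n) - pow (1ℚ + x) (β n)) - pow x (α′ n) * pow (1ℚ + x) (β n))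

  G : ℚ → ℚ
  G x = ∑ s (λ n → Gₙ n x)

  ode-fₙ : ∀ x n → 1 ≤ n → n ≤ s →
    (1ℚ + x) * f′ₙ n x - fromℕ w * fₙ n x ≡ Gₙ n x + c n * pow x (α′ n) - Rₙ n x + Rₙ n (1ℚ + x)
  ode-fₙ x n 1≤n n≤s = begin
    (1ℚ + x) * f′ₙ n x - fromℕ w * fₙ n x           ≡⟨ cong₂ (λ Z W → (1ℚ + x) * F′ Z - W * F Z) split-β w≡a+e ⟩
    (1ℚ + x) * F′ ((1ℚ + x) * z) - (a + e) * F ((1ℚ + x) * z) ≡⟨ identity (b n) a e x u v z t ⟩
    RHS (b n * a) ((1ℚ + x) * z)                    ≡⟨ cong₂ RHS (b*α≡c n) (sym split-β) ⟩
    RHS (c n) (pow (1ℚ + x) (β n))                  ∎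
    where
    open ≡-Reasoning
    a = fromℕ (α n)
    e = fromℕ (β n)
    u = pow x (α′ n)
    v = pow (1ℚ + x) (α′ n)
    z = pow (1ℚ + x) (β′ n)
    t = pow x (β n)
    F′ : ℚ → ℚ
    F′ Z = b n * ((a * u - a * v) - (a * u * Z + (x * u) * (e * z)))
    F : ℚ → ℚ
    F Z = b n * ((x * u - (1ℚ + x) * v) - (x * u) * Z)
    RHS : ℚ → ℚ → ℚ
    RHS c Z = c * ((t - Z) - u * Z) + c * u - (c * t + e * b n * (x * u)) + (c * Z + e * b n * ((1ℚ + x) * v))
    identity : ∀ b a e x u v z t →
      (1ℚ + x) * (b * ((a * u - a * v) - (a * u * ((1ℚ + x) * z) + (x * u) * (e * z))))
        - (a + e) * (b * ((x * u - (1ℚ + x) * v) - (x * u) * ((1ℚ + x) * z)))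
      ≡ (b * a) * ((t - (1ℚ + x) * z) - u * ((1ℚ + x) * z)) + (b * a) * u - ((b * a) * t + e * b * (x * u))
        + ((b * a) * ((1ℚ + x) * z) + e * b * ((1ℚ + x) * v))
    identity = solve-∀ ℚ-ring
    split-β : pow (1ℚ + x) (β n) ≡ (1ℚ + x) * z
    split-β = pow-pred (1ℚ + x) (1≤β 1≤n)
    w≡a+e : fromℕ w ≡ a + e
    w≡a+e = trans (cong fromℕ (sym (α+β≡w n≤s))) (fromℕ-+ (α n) (β n))

  ode-f : ∀ x → (1ℚ + x) * f′ x - fromℕ w * f x ≡ G x + Q′ x - R x + R (1ℚ + x)
  ode-f x = begin
    (1ℚ + x) * f′ x - fromℕ w * f x
      ≡⟨ cong₂ _-_ (∑-*ˡ s (1ℚ + x) (λ n → f′ₙ n x)) (∑-*ˡ s (fromℕ w) (λ n → fₙ n x)) ⟨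
    ∑ s (λ n → (1ℚ + x) * f′ₙ n x) - ∑ s (λ n → fromℕ w * fₙ n x)
      ≡⟨ ∑-- s _ _ ⟨
    ∑ s (λ n → (1ℚ + x) * f′ₙ n x - fromℕ w * fₙ n x)
      ≡⟨ ∑-cong s (ode-fₙ x) ⟩
    ∑ s (λ n → Gₙ n x + c n * pow x (α′ n) - Rₙ n x + Rₙ n (1ℚ + x))
      ≡⟨ ∑-+ s _ (λ n → Rₙ n (1ℚ + x)) ⟩
    ∑ s (λ n → Gₙ n x + c n * pow x (α′ n) - Rₙ n x) + R (1ℚ + x)
      ≡⟨ cong (_+ R (1ℚ + x)) (∑-- s _ (λ n → Rₙ n x)) ⟩
    ∑ s (λ n → Gₙ n x + c n * pow x (α′ n)) - R x + R (1ℚ + x)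
      ≡⟨ cong (λ t → t - R x + R (1ℚ + x)) (∑-+ s (λ n → Gₙ n x) _) ⟩
    G x + Q′ x - R x + R (1ℚ + x)
      ∎
    where open ≡-Reasoning

  reflect-1+ : ∀ x (x≢0 : x ≢ 0ℚ) {n} → n ≤ s →
    pow x w₁ * pow (1ℚ + inv x x≢0) (β n) ≡ pow x (α′ n) * pow (1ℚ + x) (β n)
  reflect-1+ x x≢0 {n} n≤s = begin
    pow x w₁ * pow (1ℚ + x⁻¹) (β n)            ≡⟨ pow-split x (1ℚ + x⁻¹) (α′ n) (β n) (α′+β≡w₁ n≤s) ⟩
    pow x (α′ n) * pow (x * (1ℚ + x⁻¹)) (β n)  ≡⟨ cong (λ t → pow x (α′ n) * pow t (β n)) (*-1+inv x x≢0) ⟩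
    pow x (α′ n) * pow (1ℚ + x) (β n)          ∎
    where
    open ≡-Reasoning
    x⁻¹ = inv x x≢0

  Gₙ-expanded : ∀ x (x≢0 : x ≢ 0ℚ) n → n ≤ s →
    Gₙ n x ≡ c n * pow x (β n) - c n * pow (1ℚ + x) (β n) - pow x w₁ * (c n * pow (1ℚ + inv x x≢0) (β n))
  Gₙ-expanded x x≢0 n n≤s = begin
    Gₙ n x
      ≡⟨ distrib (c n) (pow x (β n)) (pow (1ℚ + x) (β n)) (pow x (α′ n)) ⟩
    c n * pow x (β n) - c n * pow (1ℚ + x) (β n) - c n * (pow x (α′ n) * pow (1ℚ + x) (β n))
      ≡⟨ cong (λ v → c n * pow x (β n) - c n * pow (1ℚ + x) (β n) - c n * v) (reflect-1+ x x≢0 n≤s) ⟨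
    c n * pow x (β n) - c n * pow (1ℚ + x) (β n) - c n * (pow x w₁ * pow (1ℚ + y) (β n))
      ≡⟨ cong (λ v → c n * pow x (β n) - c n * pow (1ℚ + x) (β n) - v) (x∙yz≈y∙xz (c n) (pow x w₁) _) ⟩
    c n * pow x (β n) - c n * pow (1ℚ + x) (β n) - pow x w₁ * (c n * pow (1ℚ + y) (β n))
      ∎
    where
    open ≡-Reasoning
    y = inv x x≢0
    distrib : ∀ c X Y U → c * ((X - Y) - U * Y) ≡ c * X - c * Y - c * (U * Y)
    distrib = solve-∀ ℚ-ring

  G≡k+o : ∀ x → x ≢ 0ℚ → G x ≡ k + eval o x
  G≡k+o x x≢0 = begin
    G x
      ≡⟨ ∑-cong s (λ n _ → Gₙ-expanded x x≢0 n) ⟩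
    ∑ s (λ n → c n * pow x (β n) - c n * pow (1ℚ + x) (β n) - pow x w₁ * (c n * pow (1ℚ + y) (β n)))
      ≡⟨ ∑-- s _ _ ⟩
    ∑ s (λ n → c n * pow x (β n) - c n * pow (1ℚ + x) (β n)) - ∑ s (λ n → pow x w₁ * (c n * pow (1ℚ + y) (β n)))
      ≡⟨ cong₂ _-_ (∑-- s _ _) (∑-*ˡ s (pow x w₁) _) ⟩
    Cₛ x - Cₛ (1ℚ + x) - pow x w₁ * Cₛ (1ℚ + y)
      ≡⟨ cong₂ (λ u v → u - v - pow x w₁ * Cₛ (1ℚ + y)) (C≡∑ x) (C≡∑ (1ℚ + x)) ⟨
    C x - C (1ℚ + x) - pow x w₁ * Cₛ (1ℚ + y)
      ≡⟨ cong (λ v → C x - C (1ℚ + x) - pow x w₁ * v) (C≡∑ (1ℚ + y)) ⟨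
    C x - C (1ℚ + x) - pow x w₁ * C (1ℚ + y)
      ≡⟨ C-relation x x≢0 ⟩
    k + eval o x
      ∎
    where
    open ≡-Reasoning
    y = inv x x≢0
    Cₛ : ℚ → ℚ
    Cₛ t = ∑ s (λ n → c n * pow t (β n))

  m : ℚ → ℚ
  m x = G x + Q′ x

  mₙ-reciprocal : ∀ x (x≢0 : x ≢ 0ℚ) n → n ≤ s →
    pow x w₁ * (Gₙ n (inv x x≢0) + c n * pow (inv x x≢0) (α′ n)) ≡ Gₙ n x + c n * pow x (α′ n)
  mₙ-reciprocal x x≢0 n n≤s = begin
    pow x w₁ * (Gₙ n y + c n * pow y (α′ n))
      ≡⟨ distrib (c n) (pow x w₁) (pow y (α′ n)) (pow y (β n)) (pow (1ℚ + y) (β n)) ⟩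
    c n * ((pow x w₁ * pow y (β n) - pow x w₁ * pow (1ℚ + y) (β n)) - (pow x w₁ * pow y (α′ n)) * pow (1ℚ + y) (β n))
      + c n * (pow x w₁ * pow y (α′ n))
      ≡⟨ cong₂ (λ u v → c n * ((u - pow x w₁ * pow (1ℚ + y) (β n)) - v * pow (1ℚ + y) (β n)) + c n * v)
           (pow-reflect x x≢0 (α′ n) (β n) (α′+β≡w₁ n≤s))
           (pow-reflect x x≢0 (β n) (α′ n) (trans (ℕ.+-comm (β n) (α′ n)) (α′+β≡w₁ n≤s))) ⟩
    c n * ((pow x (α′ n) - pow x w₁ * pow (1ℚ + y) (β n)) - pow x (β n) * pow (1ℚ + y) (β n)) + c n * pow x (β n)
      ≡⟨ cong₂ (λ u v → c n * ((pow x (α′ n) - u) - v) + c n * pow x (β n))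
           (reflect-1+ x x≢0 n≤s)
           (trans (sym (pow-* x (1ℚ + y) (β n))) (cong (λ t → pow t (β n)) (*-1+inv x x≢0))) ⟩
    c n * ((pow x (α′ n) - pow x (α′ n) * pow (1ℚ + x) (β n)) - pow (1ℚ + x) (β n)) + c n * pow x (β n)
      ≡⟨ rearrange (c n) (pow x (α′ n)) (pow (1ℚ + x) (β n)) (pow x (β n)) ⟩
    Gₙ n x + c n * pow x (α′ n)
      ∎
    where
    open ≡-Reasoning
    y = inv x x≢0
    distrib : ∀ c P Y₁ Yₑ Z → P * (c * ((Yₑ - Z) - Y₁ * Z) + c * Y₁) ≡ c * ((P * Yₑ - P * Z) - (P * Y₁) * Z) + c * (P * Y₁)
    distrib = solve-∀ ℚ-ring
    rearrange : ∀ c A Z E → c * ((A - A * Z) - Z) + c * E ≡ c * ((E - Z) - A * Z) + c * A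
    rearrange = solve-∀ ℚ-ring

  m-reciprocal : ∀ x (x≢0 : x ≢ 0ℚ) → m x ≡ pow x w₁ * m (inv x x≢0)
  m-reciprocal x x≢0 = begin
    G x + Q′ x                                          ≡⟨ ∑-+ s _ _ ⟨
    ∑ s (λ n → Gₙ n x + c n * pow x (α′ n))             ≡⟨ ∑-cong s (λ n _ n≤s → mₙ-reciprocal x x≢0 n n≤s) ⟨
    ∑ s (λ n → pow x w₁ * (Gₙ n y + c n * pow y (α′ n))) ≡⟨ ∑-*ˡ s (pow x w₁) _ ⟩
    pow x w₁ * ∑ s (λ n → Gₙ n y + c n * pow y (α′ n))   ≡⟨ cong (pow x w₁ *_) (∑-+ s _ _) ⟩
    pow x w₁ * m y                                       ∎
    where
    open ≡-Reasoning
    y = inv x x≢0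

  odd-part : ℚ → ℚ
  odd-part x = eval o x + Q′ x

  odd-part-odd : ∀ x → odd-part (- x) ≡ - odd-part x
  odd-part-odd x = trans (cong₂ _+_ (o-odd x) Q′-odd) (sym (neg-distrib-+ (eval o x) (Q′ x)))
    where
    Q′-odd : Q′ (- x) ≡ - Q′ x
    Q′-odd = trans (∑-cong s (λ n _ _ → trans (cong (c n *_) (pow-neg-odd x (s ∸ n))) (sym (neg-distribʳ-* (c n) _))))
                   (∑-neg s _)

  m≡k+odd-part : ∀ x → x ≢ 0ℚ → m x ≡ k + odd-part x
  m≡k+odd-part x x≢0 = trans (cong (_+ Q′ x) (G≡k+o x x≢0)) (+-assoc k (eval o x) (Q′ x))

  m≡k+k*x^w₁ : ∀ x → x ≢ 0ℚ → m x ≡ k + k * pow x w₁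
  m≡k+k*x^w₁ = reciprocal+odd⇒explicit s m odd-part k odd-part-odd m-reciprocal m≡k+odd-part

  -- h is chosen so that ode-h has the shape k (1 + x^w₁) of m; κ h then cancels m in ode-ψ.
  h : ℚ → ℚ
  h x = (pow x w - 1ℚ) + pow (1ℚ + x) w

  h′ : ℚ → ℚ
  h′ x = (fromℕ w * pow x w₁ - 0ℚ) + fromℕ w * pow (1ℚ + x) w₁

  hₚ : Poly
  hₚ = (X ^ₚ w -ₚ 1ₚ) +ₚ X+1 ^ₚ w

  realises-h : Realises hₚ h h′
  realises-h = realises-+ₚ (realises--ₚ (realises-X^ w) (realises-const 1ℚ)) (realises-X+1^ w)

  ode-h : ∀ x → (1ℚ + x) * h′ x - fromℕ w * h x ≡ fromℕ w * (1ℚ + pow x w₁)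
  ode-h x = identity x (fromℕ w) (pow x w₁) (pow (1ℚ + x) w₁)
    where
    identity : ∀ x W P₁ P₂ →
      (1ℚ + x) * ((W * P₁ - 0ℚ) + W * P₂) - W * ((x * P₁ - 1ℚ) + (1ℚ + x) * P₂) ≡ W * (1ℚ + P₁)
    identity = solve-∀ ℚ-ring

  w≢0 : fromℕ w ≢ 0ℚ
  w≢0 = fromℕ-suc≢0 w₁

  κ : ℚ
  κ = - (k * inv (fromℕ w) w≢0)

  κ*w≡-k : κ * fromℕ w ≡ - k
  κ*w≡-k = trans (regroup k W⁻¹ W) (trans (cong (λ t → - (k * t)) (inv-inverseˡ W w≢0)) (cong -_ (*-identityʳ k)))
    where
    W = fromℕ w
    W⁻¹ = inv W w≢0
    regroup : ∀ k i W → - (k * i) * W ≡ - (k * (i * W))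
    regroup = solve-∀ ℚ-ring

  ψ : ℚ → ℚ
  ψ x = f x + κ * h x

  ψ′ : ℚ → ℚ
  ψ′ x = f′ x + κ * h′ x

  realises-ψ : Realises (fₚ +ₚ κ ·ₚ hₚ) ψ ψ′
  realises-ψ = realises-+ₚ realises-f (realises-·ₚ κ realises-h)

  ode-ψ : ∀ n → (1ℚ + fromℕ (suc n)) * ψ′ (fromℕ (suc n)) - fromℕ w * ψ (fromℕ (suc n)) ≡ 0ℚ
  ode-ψ n = begin
    (1ℚ + x) * (f′ x + κ * h′ x) - W * (f x + κ * h x)
      ≡⟨ linear (1ℚ + x) W (f′ x) (f x) κ (h′ x) (h x) ⟩
    ((1ℚ + x) * f′ x - W * f x) + κ * ((1ℚ + x) * h′ x - W * h x)
      ≡⟨ cong₂ (λ u v → u + κ * v) (ode-f x) (ode-h x) ⟩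
    (m x - R x + R (1ℚ + x)) + κ * (W * (1ℚ + P))
      ≡⟨ cong₂ (λ u v → (m x - u + v) + κ * (W * (1ℚ + P))) (R≡0 x x≢0) (R≡0 (1ℚ + x) 1+x≢0) ⟩
    (m x - 0ℚ + 0ℚ) + κ * (W * (1ℚ + P))
      ≡⟨ cong (λ t → (t - 0ℚ + 0ℚ) + κ * (W * (1ℚ + P))) (m≡k+k*x^w₁ x x≢0) ⟩
    ((k + k * P) - 0ℚ + 0ℚ) + κ * (W * (1ℚ + P))
      ≡⟨ regroup k P κ W ⟩
    (k + κ * W) * (1ℚ + P)
      ≡⟨ cong (λ t → (k + t) * (1ℚ + P)) κ*w≡-k ⟩
    (k + - k) * (1ℚ + P)
      ≡⟨ vanish k P ⟩
    0ℚ
      ∎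
    where
    open ≡-Reasoning
    x = fromℕ (suc n)
    x≢0 = fromℕ-suc≢0 n
    1+x≢0 : 1ℚ + x ≢ 0ℚ
    1+x≢0 eq = fromℕ-suc≢0 (suc n) (trans (fromℕ-suc (suc n)) eq)
    W = fromℕ w
    P = pow x w₁
    linear : ∀ y W F′ F κ H′ H → y * (F′ + κ * H′) - W * (F + κ * H) ≡ (y * F′ - W * F) + κ * (y * H′ - W * H)
    linear = solve-∀ ℚ-ring
    regroup : ∀ k P κ W → ((k + k * P) - 0ℚ + 0ℚ) + κ * (W * (1ℚ + P)) ≡ (k + κ * W) * (1ℚ + P)
    regroup = solve-∀ ℚ-ring
    vanish : ∀ k P → (k + - k) * (1ℚ + P) ≡ 0ℚ
    vanish = solve-∀ ℚ-ring

  ∑b≡0 : ∑ s b ≡ 0ℚ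
  ∑b≡0 = x≢0∧x*y≡0⇒y≡0 {1ℚ + 1ℚ} (λ ()) (begin
    (1ℚ + 1ℚ) * ∑ s b  ≡⟨ ∑-*ˡ s (1ℚ + 1ℚ) b ⟨
    ∑ s (λ n → (1ℚ + 1ℚ) * b n) ≡⟨ ∑-cong s (λ n _ _ → at-1 n) ⟩
    A 1ℚ               ≡⟨ A≡0 1ℚ (λ ()) ⟩
    0ℚ                 ∎)
    where
    open ≡-Reasoning
    comm : ∀ b → (1ℚ + 1ℚ) * b ≡ b * (1ℚ + 1ℚ)
    comm = solve-∀ ℚ-ring
    at-1 : ∀ n → (1ℚ + 1ℚ) * b n ≡ b n * (pow 1ℚ (α n) + pow 1ℚ (β n))
    at-1 n = trans (comm (b n)) (sym (cong₂ (λ u v → b n * (u + v)) (pow-1ℚ (α n)) (pow-1ℚ (β n))))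

  f0≡0 : f 0ℚ ≡ 0ℚ
  f0≡0 = trans (∑-cong s term) (trans (∑-neg s b) (cong -_ ∑b≡0))
    where
    simplify : ∀ b z → b * ((0ℚ * z - 1ℚ) - (0ℚ * z) * 1ℚ) ≡ - b
    simplify = solve-∀ ℚ-ring
    term : ∀ n → 1 ≤ n → n ≤ s → fₙ n 0ℚ ≡ - b n
    term n _ _ = trans (cong₂ (λ u v → b n * ((pow 0ℚ (α n) - u) - pow 0ℚ (α n) * v))
                               (trans (cong (λ t → pow t (α n)) (+-identityʳ 1ℚ)) (pow-1ℚ (α n)))
                               (trans (cong (λ t → pow t (β n)) (+-identityʳ 1ℚ)) (pow-1ℚ (β n))))
                       (simplify (b n) (pow 0ℚ (α′ n)))

  f1≡0 : f 1ℚ ≡ 0ℚ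
  f1≡0 = begin
    f 1ℚ                                 ≡⟨ ∑-cong s term ⟩
    ∑ s (λ n → b n - b n * (pow 2ℚ (α n) + pow 2ℚ (β n))) ≡⟨ ∑-- s b _ ⟩
    ∑ s b - A 2ℚ                         ≡⟨ cong₂ _-_ ∑b≡0 (A≡0 2ℚ (λ ())) ⟩
    0ℚ - 0ℚ                              ≡⟨⟩
    0ℚ                                   ∎
    where
    open ≡-Reasoning
    2ℚ = 1ℚ + 1ℚ
    simplify : ∀ b A E → b * ((1ℚ - A) - 1ℚ * E) ≡ b - b * (A + E)
    simplify = solve-∀ ℚ-ring
    term : ∀ n → 1 ≤ n → n ≤ s → fₙ n 1ℚ ≡ b n - b n * (pow 2ℚ (α n) + pow 2ℚ (β n))
    term n _ _ = trans (cong (λ u → b n * ((u - pow 2ℚ (α n)) - u * pow 2ℚ (β n))) (pow-1ℚ (α n)))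
                       (simplify (b n) (pow 2ℚ (α n)) (pow 2ℚ (β n)))

  ψ≡0 : ∀ x → ψ x ≡ 0ℚ
  ψ≡0 = ode-uniqueness (fromℕ w) realises-ψ ode-ψ ψ0≡0
    where
    h0≡0 : h 0ℚ ≡ 0ℚ
    h0≡0 = cong₂ (λ u v → (u - 1ℚ) + v) (*-zeroˡ (pow 0ℚ w₁)) (trans (cong (λ t → pow t w) (+-identityʳ 1ℚ)) (pow-1ℚ w))
    ψ0≡0 : ψ 0ℚ ≡ 0ℚ
    ψ0≡0 = trans (cong₂ (λ u v → u + κ * v) f0≡0 h0≡0) (trans (+-identityˡ _) (*-zeroʳ κ))

  -- Evaluating ψ at 1, where f vanishes and h does not, forces κ = 0.
  f≡0 : ∀ x → f x ≡ 0ℚ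
  f≡0 x = begin
    f x            ≡⟨ +-identityʳ (f x) ⟨
    f x + 0ℚ       ≡⟨ cong (f x +_) (trans (cong (_* h x) κ≡0) (*-zeroˡ (h x))) ⟨
    f x + κ * h x  ≡⟨ ψ≡0 x ⟩
    0ℚ             ∎
    where
    open ≡-Reasoning
    h1≢0 : h 1ℚ ≢ 0ℚ
    h1≢0 eq = pow≢0 (1ℚ + 1ℚ) w (λ ()) (begin
      pow (1ℚ + 1ℚ) w                     ≡⟨ +-identityˡ _ ⟨
      (1ℚ - 1ℚ) + pow (1ℚ + 1ℚ) w         ≡⟨ cong (λ u → (u - 1ℚ) + pow (1ℚ + 1ℚ) w) (pow-1ℚ w) ⟨
      h 1ℚ                                ≡⟨ eq ⟩
      0ℚ                                  ∎)
    κ≡0 : κ ≡ 0ℚ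
    κ≡0 = x≢0∧x*y≡0⇒y≡0 h1≢0 (trans (*-comm (h 1ℚ) κ)
            (trans (sym (+-identityˡ _)) (trans (cong (_+ κ * h 1ℚ) (sym f1≡0)) (ψ≡0 1ℚ))))

  q-even : ∀ y → eval q (- y) ≡ eval q y
  q-even y = trans (q≡Q (- y)) (trans (∑-cong s (λ n _ _ → cong (b n *_) (pow-neg-α y n))) (sym (q≡Q y)))

  q-two-term : ∀ x (x≢0 : x ≢ 0ℚ) → eval q x + pow x w * eval q (- inv x x≢0) ≡ 0ℚ
  q-two-term x x≢0 = trans (cong (λ t → eval q x + pow x w * t) (q-even (inv x x≢0))) (q-recip x x≢0)

  three-term-summand : ∀ x (x≢0 : x ≢ 0ℚ) n → n ≤ s →
    b n * pow x (α n) + pow x w * (b n * pow (1ℚ - inv x x≢0) (α n)) - b n * pow (x - 1ℚ) (α n)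
      ≡ - fₙ n (x - 1ℚ)
  three-term-summand x x≢0 n n≤s = begin
    b n * pow x (α n) + pow x w * (b n * pow (1ℚ - y) (α n)) - b n * pow z (α n)
      ≡⟨ cong (λ t → b n * pow x (α n) + t - b n * pow z (α n)) (x∙yz≈y∙xz (pow x w) (b n) _) ⟩
    b n * pow x (α n) + b n * (pow x w * pow (1ℚ - y) (α n)) - b n * pow z (α n)
      ≡⟨ cong (λ t → b n * pow x (α n) + b n * t - b n * pow z (α n))
           (pow-split x (1ℚ - y) (β n) (α n) (trans (ℕ.+-comm (β n) (α n)) (α+β≡w n≤s))) ⟩
    b n * pow x (α n) + b n * (pow x (β n) * pow (x * (1ℚ - y)) (α n)) - b n * pow z (α n)
      ≡⟨ cong (λ t → b n * pow x (α n) + b n * (pow x (β n) * pow t (α n)) - b n * pow z (α n)) (*-1-inv x x≢0) ⟩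
    b n * pow x (α n) + b n * (pow x (β n) * pow z (α n)) - b n * pow z (α n)
      ≡⟨ regroup (b n) (pow x (α n)) (pow x (β n)) (pow z (α n)) ⟩
    - (b n * ((pow z (α n) - pow x (α n)) - pow z (α n) * pow x (β n)))
      ≡⟨ cong (λ t → - (b n * ((pow z (α n) - pow t (α n)) - pow z (α n) * pow t (β n)))) (1+[x-1]≡x x) ⟨
    - fₙ n z
      ∎
    where
    open ≡-Reasoning
    y = inv x x≢0
    z = x - 1ℚ
    regroup : ∀ b X Xₑ Z → b * X + b * (Xₑ * Z) - b * Z ≡ - (b * ((Z - X) - Z * Xₑ))
    regroup = solve-∀ ℚ-ring
    1+[x-1]≡x : ∀ x → 1ℚ + (x - 1ℚ) ≡ x
    1+[x-1]≡x = solve-∀ ℚ-ring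

  -- With z = x - 1, the last term is -q(z) by reciprocity, and the rest is -f(z).
  q-three-term : ∀ x (x≢0 : x ≢ 0ℚ) (z≢0 : x - 1ℚ ≢ 0ℚ) →
    eval q x + pow x w * eval q (1ℚ - inv x x≢0) + pow (x - 1ℚ) w * eval q (- inv (x - 1ℚ) z≢0) ≡ 0ℚ
  q-three-term x x≢0 z≢0 = begin
    eval q x + pow x w * eval q (1ℚ - y) + pow z w * eval q (- inv z z≢0)
      ≡⟨ cong (eval q x + pow x w * eval q (1ℚ - y) +_) last≡-q[z] ⟩
    eval q x + pow x w * eval q (1ℚ - y) - eval q z
      ≡⟨ cong₂ (λ u v → u + pow x w * v - eval q z) (q≡Q x) (q≡Q (1ℚ - y)) ⟩
    Q x + pow x w * Q (1ℚ - y) - eval q z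
      ≡⟨ cong₂ (λ u v → Q x + u - v) (∑-*ˡ s (pow x w) _) (sym (q≡Q z)) ⟨
    Q x + ∑ s (λ n → pow x w * (b n * pow (1ℚ - y) (α n))) - Q z
      ≡⟨ cong (_- Q z) (∑-+ s _ _) ⟨
    ∑ s (λ n → b n * pow x (α n) + pow x w * (b n * pow (1ℚ - y) (α n))) - Q z
      ≡⟨ ∑-- s _ _ ⟨
    ∑ s (λ n → b n * pow x (α n) + pow x w * (b n * pow (1ℚ - y) (α n)) - b n * pow z (α n))
      ≡⟨ ∑-cong s (λ n _ → three-term-summand x x≢0 n) ⟩
    ∑ s (λ n → - fₙ n z)
      ≡⟨ ∑-neg s (λ n → fₙ n z) ⟩
    - f z
      ≡⟨ cong -_ (f≡0 z) ⟩
    0ℚ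
      ∎
    where
    open ≡-Reasoning
    y = inv x x≢0
    z = x - 1ℚ
    last≡-q[z] : pow z w * eval q (- inv z z≢0) ≡ - eval q z
    last≡-q[z] = trans (cong (pow z w *_) (q-even (inv z z≢0))) (x+y≡0⇒y≡-x (q-recip z z≢0))

  q∈W⁻ : InW⁻ (suc (suc w)) q
  q∈W⁻ = (q-two-term , q-three-term) , q0≡0 , q-recip

odd≥5⇒3+2s : ∀ N → 5 ≤ N → N % 2 ≡ 1 → Σ ℕ (λ s → N ≡ 3 ℕ.+ 2 ℕ.* s)
odd≥5⇒3+2s N 5≤N N%2≡1 = split (N / 2) (trans (ℕ.m≡m%n+[m/n]*n N 2) (cong (ℕ._+ (N / 2) ℕ.* 2) N%2≡1))
  where
  split : ∀ t → N ≡ 1 ℕ.+ t ℕ.* 2 → Σ ℕ (λ s → N ≡ 3 ℕ.+ 2 ℕ.* s)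
  split zero    N≡1 = ⊥-elim (5≰1 (subst (5 ≤_) N≡1 5≤N))
    where
    5≰1 : ¬ 5 ≤ 1
    5≰1 (ℕ.s≤s ())
  split (suc t) N≡ = t , trans N≡ (cong (3 ℕ.+_) (ℕ.*-comm t 2))

2s/2≡s : ∀ s → 2 ℕ.* s / 2 ≡ s
2s/2≡s s = trans (cong (_/ 2) (ℕ.*-comm 2 s)) (ℕ.m*n/n≡m s 2)

lemma2 : (N : ℕ) → 5 ≤ N → N % 2 ≡ 1 →
    (c : ℕ → ℚ) → (q : Poly) →
    Σ ℚ (λ k → Σ Poly (λ o → IsOddPoly o ×
      ((x : ℚ) (x≢0 : x ≢ 0ℚ) →
        sumC c ((N ∸ 3) / 2) x - sumC c ((N ∸ 3) / 2) (1ℚ + x)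
          - pow x (N ∸ 2) * sumC c ((N ∸ 3) / 2) (1ℚ + inv x x≢0)
          ≡ k + eval o x))) →
    ((x : ℚ) (x≢0 : x ≢ 0ℚ) →
      sumC c ((N ∸ 3) / 2) x ≡ pow x (N ∸ 2) * eval (deriv q) (inv x x≢0)) →
    ((x : ℚ) (x≢0 : x ≢ 0ℚ) →
      eval q x + pow x (N ∸ 1) * eval q (inv x x≢0) ≡ 0ℚ) →
    eval q 0ℚ ≡ 0ℚ →
    InW⁻ (ℕ.suc N) q
lemma2 N 5≤N N-odd c q (k , o , o-odd , C-relation) C≡q′ q-recip q0≡0
  with odd≥5⇒3+2s N 5≤N N-odd
... | s , refl with 2 ℕ.* s / 2 | 2s/2≡s s
...   | .s | refl = Proof.q∈W⁻ s c q k o o-odd C-relation C≡q′ q-recip q0≡0
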